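{- Let $c$ be a Coxeter element of $A_n$ and let $X\in\mathsf{Aff}(c)$. Then: for each upper-barred number $u$, $X(i,u)=0$ for all $1\le i\le\min(u-1,n+1-u)$; and for each lower-barred number $d$, $X(i,d)=0$ for all $\max(d+1,n+3-d)\le i\le n+1$.
   Context: $A_n$ is the symmetric group on $[n+1]$, $s_i$ exchanges $i,i+1$, permutations compose as functions. A Coxeter element is $c=s_{a_1}\cdots s_{a_n}$ with $(a_1,\dots,a_n)$ a permutation of $[n]$. $\mathrm{sort}_c(w)$ is the lexicographically first subword of $c^\infty=a_1\cdots a_na_1\cdots a_n\cdots$ that is a reduced word for $w$; $w$ is $c$-sortable if the sets $K_j$ of letters from the $j$-th copy satisfy $K_1\supseteq K_2\supseteq\cdots$; $\pi^c_\downarrow(w)$ is the largest $c$-sortable element weakly below $w$ in right weak order; a $c$-singleton is a $c$-sortable $w$ with $(\pi^c_\downarrow)^{ -1}(w)=\{w\}$. $X(w)$ is the $(n+1)\times(n+1)$ matrix with $1$ at $(i,w(i))$ and $0$ elsewhere; $\mathsf{Aff}(c)$ is the affine span of $\{X(w): w \text{ a } c\text{ -singleton}\}$. For $i\in\{2,\dots,n\}$, $i$ is lower-barred if $i-1$ precedes $i$ in $(a_1,\dots,a_n)$, and upper-barred otherwise.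
   Formalization: The affine span $\mathsf{Aff}(c)$ is taken over ℚ, with rational affine coefficients, so each matrix $X$ in it has rational entries. -}

module Defs where

open import Data.Nat using (ℕ; zero; suc; _+_; _≤_; _<_)
open import Data.Fin using (Fin; toℕ; inject₁) renaming (suc to fsuc; _≟_ to _≟ᶠ_)
open import Data.Fin.Permutation using (Permutation′; _⟨$⟩ʳ_; _⟨$⟩ˡ_)
open import Data.List using (List; []; _∷_; _++_; length; foldr; map)
open import Data.List.Membership.Propositional using (_∈_)
open import Data.List.Relation.Unary.All using (All)
open import Data.Product using (Σ; ∃; ∃-syntax; _×_; _,_; proj₁; proj₂)
open import Data.Sum using (_⊎_)
open import Data.Rational using (ℚ; 0ℚ; 1ℚ) renaming (_+_ to _+ℚ_; _*_ to _*ℚ_)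
open import Relation.Nullary using (¬_; does)
open import Relation.Binary.PropositionalEquality using (_≡_)
open import Data.Bool using (if_then_else_)

-- The symmetric group A_n = S_{n+1}.
-- Elements of [n+1] are  Fin (suc n)  (value i+1 is represented by i).  Letters (indices of simple generators) s_1..s_n are
-- Fin n: letter k represents s_{toℕ k + 1}.

Perm : ℕ → Set
Perm n = Fin (suc n) → Fin (suc n)

_≈_ : ∀ {n} → Perm n → Perm n → Set
u ≈ w = ∀ i → u i ≡ w i

idP : ∀ {n} → Perm n
idP i = i

s : ∀ {n} → Fin n → Perm n
s k i = if does (i ≟ᶠ inject₁ k) then fsuc k
        else (if does (i ≟ᶠ fsuc k) then inject₁ k else i)

prod : ∀ {n} → List (Fin n) → Perm n
prod []       = idP
prod (x ∷ xs) = λ i → s x (prod xs i)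

Reduced : ∀ {n} → List (Fin n) → Perm n → Set
Reduced {n} ws w =
  (prod ws ≈ w) × (∀ (vs : List (Fin n)) → prod vs ≈ w → length ws ≤ length vs)

_≤R_ : ∀ {n} → Perm n → Perm n → Set
_≤R_ {n} u w = Σ (List (Fin n)) λ as → Σ (List (Fin n)) λ bs →
  Reduced as u × Reduced (as ++ bs) w

-- Coxeter elements c = s_{a_1} ... s_{a_n}: the sequence (a_1,...,a_n)
-- is a permutation a of the letters, a ⟨$⟩ʳ r = a_{r+1}.

Coxeter : ℕ → Set
Coxeter n = Permutation′ n

-- A position in c^∞ = a_1 ... a_n a_1 ... a_n ... is a pair (j , r):
-- the (r+1)-th letter of the (j+1)-th copy.  Positions are ordered
-- lexicographically (= their order in c^∞).
Pos : ℕ → Set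
Pos n = ℕ × Fin n

_<P_ : ∀ {n} → Pos n → Pos n → Set
(j , r) <P (j' , r') = (j < j') ⊎ ((j ≡ j') × (toℕ r < toℕ r'))

-- strictly increasing list of positions = a subword of c^∞
data Increasing {n} : List (Pos n) → Set where
  inc-[]  : Increasing []
  inc-one : ∀ p → Increasing (p ∷ [])
  inc-∷   : ∀ p q ps → p <P q → Increasing (q ∷ ps) → Increasing (p ∷ q ∷ ps)

letters : ∀ {n} → Coxeter n → List (Pos n) → List (Fin n)
letters a = map (λ p → a ⟨$⟩ʳ proj₂ p)

ReducedSubword : ∀ {n} → Coxeter n → Perm n → List (Pos n) → Set
ReducedSubword a w ps = Increasing ps × Reduced (letters a ps) w

data _≤Lex_ {n} : List (Pos n) → List (Pos n) → Set where
  lex-[] : ∀ qs → [] ≤Lex qs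
  lex-<  : ∀ p q ps qs → p <P q → (p ∷ ps) ≤Lex (q ∷ qs)
  lex-≡  : ∀ p ps qs → ps ≤Lex qs → (p ∷ ps) ≤Lex (p ∷ qs)

IsSort : ∀ {n} → Coxeter n → Perm n → List (Pos n) → Set
IsSort a w ps = ReducedSubword a w ps ×
  (∀ qs → ReducedSubword a w qs → ps ≤Lex qs)

_∈K_[_] : ∀ {n} → Fin n → ℕ → (Coxeter n × List (Pos n)) → Set
x ∈K j [ a , ps ] = Σ (Pos _) λ p → (p ∈ ps) × (proj₁ p ≡ j) × (a ⟨$⟩ʳ proj₂ p ≡ x)

Sortable : ∀ {n} → Coxeter n → Perm n → Set
Sortable {n} a w = Σ (List (Pos n)) λ ps → IsSort a w ps ×
  (∀ (j : ℕ) (x : Fin n) → x ∈K (suc j) [ a , ps ] → x ∈K j [ a , ps ])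

IsPiDown : ∀ {n} → Coxeter n → Perm n → Perm n → Set
IsPiDown {n} a v u = Sortable a u × (u ≤R v) ×
  (∀ (u' : Perm n) → Sortable a u' → u' ≤R v → u' ≤R u)

Singleton : ∀ {n} → Coxeter n → Perm n → Set
Singleton {n} a w = Sortable a w × (∀ (v : Perm n) → IsPiDown a v w → v ≈ w)

Matrix : ℕ → Set
Matrix n = Fin (suc n) → Fin (suc n) → ℚ

PM : ∀ {n} → Perm n → Matrix n
PM w i j = if does (w i ≟ᶠ j) then 1ℚ else 0ℚ

sumℚ : List ℚ → ℚ
sumℚ = foldr _+ℚ_ 0ℚ

InAff : ∀ {n} → Coxeter n → Matrix n → Set
InAff {n} a X = Σ (List (ℚ × Perm n)) λ cs →
  All (λ lw → Singleton a (proj₂ lw)) cs ×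
  (sumℚ (map proj₁ cs) ≡ 1ℚ) ×
  (∀ i j → X i j ≡ sumℚ (map (λ lw → proj₁ lw *ℚ PM (proj₂ lw) i j) cs))

Precedes : ∀ {n} → Coxeter n → Fin n → Fin n → Set
Precedes a x y = toℕ (a ⟨$⟩ˡ x) < toℕ (a ⟨$⟩ˡ y)

-- d is lower-barred: d-1 precedes d   (letter d is the Fin n index d-1)
LowerBarred : ∀ {n} → Coxeter n → ℕ → Set
LowerBarred {n} a d = 2 ≤ d × d ≤ n ×
  Σ (Fin n) λ x → Σ (Fin n) λ y →
    (toℕ x + 2 ≡ d) × (toℕ y + 1 ≡ d) × Precedes a x y

UpperBarred : ∀ {n} → Coxeter n → ℕ → Set
UpperBarred {n} a d = 2 ≤ d × d ≤ n ×
  Σ (Fin n) λ x → Σ (Fin n) λ y →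
    (toℕ x + 2 ≡ d) × (toℕ y + 1 ≡ d) × ¬ Precedes a x y

-- A c-singleton w is c-sortable, and c-sortable permutations avoid two barred patterns:
-- no values a < b < c appear in the order b c a with b upper-barred, or in the order c a b
-- with b lower-barred.  This holds because a sorting word is read off c cyclically, each
-- letter being dropped for good once it is skipped, and induction along such reduced words
-- keeps the patterns out.
--
-- Suppose w(i) = u with u upper-barred and i ≤ min(u - 1, n + 1 - u).  There are too few
-- positions left of i to hold all values below u, or all values above u, so both kinds occur
-- right of i; pattern avoidance puts the small one first, and in between w has an ascent
-- w(k) < u < w(k+1).  As w is a c-singleton, π↓(w s_k) ≠ w, so some c-sortable u′ ≤ w s_k
-- swaps w(k) and w(k+1); but u′ keeps u before w(k+1) and so contains u w(k+1) w(k), a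
-- forbidden pattern.  Lower-barred numbers are the mirror image.  Every matrix in Aff(c) is
-- an affine combination of permutation matrices of c-singletons, so these entries vanish.

module Submission where

open import Defs
open import Data.Nat using (ℕ; zero; suc; _+_; _*_; _∸_; _≤_; _<_; _⊓_; _⊔_; z≤n; s≤s; z<s)
open import Data.Nat.Properties
open import Data.Fin using (Fin; toℕ; inject₁; fromℕ<; fromℕ; punchIn)
  renaming (zero to fzero; suc to fsuc; _≟_ to _≟ᶠ_; _<_ to _<ᶠ_; _≤_ to _≤ᶠ_)
open import Data.Fin.Properties
  using (toℕ-injective; toℕ-inject₁; toℕ-fromℕ<; toℕ-fromℕ; toℕ<n; toℕ≤pred[n]; punchInᵢ≢i;
         injective⇒≤; any?)
  renaming (≤∧≢⇒< to ≤∧≢⇒<ᶠ)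
open import Data.Fin.Induction using (<-weakInduction; >-weakInduction)
open import Data.Fin.Permutation using (transpose; _⟨$⟩ʳ_; _⟨$⟩ˡ_; inverseˡ; inverseʳ)
import Data.Fin.Permutation.Components as PC
open import Algebra.Properties.CommutativeMonoid.Sum +-0-commutativeMonoid
  using (sum; sum-syntax; sum-cong-≗; sum-remove; sum-permute; sum-replicate-zero)
open import Data.Product using (Σ; _×_; _,_; proj₁; proj₂)
open import Data.Sum using (_⊎_; inj₁; inj₂)
open import Data.Unit using (⊤; tt)
open import Data.Empty using (⊥; ⊥-elim)
open import Data.Bool using (true; false)
open import Data.List using (List; []; _∷_; _++_; length; map; tabulate; filter; drop; take)
open import Data.List.Properties
  using (length-++; length-tabulate; take-suc-tabulate; take-all; drop-all; filter-accept; filter-reject;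
         filter-++; filter-all; ++-identityʳ; ++-assoc)
open import Data.List.Membership.Propositional using (_∈_; _∉_; find; lose)
open import Data.List.Membership.Propositional.Properties using (∈-++⁺ˡ; ∈-++⁺ʳ; ∈-++⁻; ∈-tabulate⁺)
open import Data.List.Relation.Unary.Any using (here; there)
import Data.List.Relation.Unary.Any as Any
open import Data.List.Relation.Unary.All using (All; []; _∷_)
import Data.List.Relation.Unary.All as All
open import Data.List.Relation.Unary.All.Properties using (All¬⇒¬Any)
open import Data.List.Relation.Unary.Unique.Propositional using (Unique; []; _∷_)
import Data.List.Relation.Unary.Unique.Propositional.Properties as Unique
open import Data.Rational using (0ℚ) renaming (_+_ to _+ℚ_; _*_ to _*ℚ_)
import Data.Rational.Properties as ℚ
open import Function using (_∘_; _⇔_; mk⇔; Equivalence)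
open import Function.Construct.Composition using (_⇔-∘_)
open import Function.Construct.Identity using (⇔-id)
open import Function.Definitions using (Injective)
open import Relation.Nullary using (¬_; Dec; yes; no; does; ¬?; _×-dec_)
open import Relation.Nullary.Decidable using (dec-true; dec-false; map′; decidable-stable)
open import Relation.Unary using (Decidable)
open import Relation.Binary.Definitions using (tri<; tri≈; tri>)
open import Relation.Binary.PropositionalEquality
  using (_≡_; _≢_; _≗_; refl; sym; trans; cong; cong₂; subst; subst₂; ≢-sym; module ≡-Reasoning)

private variable n : ℕ

-- Simple transpositions

inject₁≢fsuc : (k : Fin n) → inject₁ k ≢ fsuc k
inject₁≢fsuc k e = <-irrefl (trans (sym (toℕ-inject₁ k)) (cong toℕ e)) (n<1+n (toℕ k))

inject₁<fsuc : (k : Fin n) → inject₁ k <ᶠ fsuc k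
inject₁<fsuc k = subst (_< suc (toℕ k)) (sym (toℕ-inject₁ k)) (n<1+n (toℕ k))

inject₁<⇒fsuc≤ : (k : Fin n) {j : Fin (suc n)} → inject₁ k <ᶠ j → fsuc k ≤ᶠ j
inject₁<⇒fsuc≤ k {j} = subst (λ m → suc m ≤ toℕ j) (toℕ-inject₁ k)

<fsuc⇒≤inject₁ : (k : Fin n) {i : Fin (suc n)} → i <ᶠ fsuc k → i ≤ᶠ inject₁ k
<fsuc⇒≤inject₁ k {i} (s≤s i≤k) = subst (toℕ i ≤_) (sym (toℕ-inject₁ k)) i≤k

data SwapCase (k : Fin n) : Fin (suc n) → Set where
  left  : SwapCase k (inject₁ k)
  right : SwapCase k (fsuc k)
  away  : ∀ {i} → i ≢ inject₁ k → i ≢ fsuc k → SwapCase k i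

swapCase : (k : Fin n) (i : Fin (suc n)) → SwapCase k i
swapCase k i with i ≟ᶠ inject₁ k | i ≟ᶠ fsuc k
... | yes refl | _        = left
... | no _     | yes refl = right
... | no i≢k   | no i≢k+1 = away i≢k i≢k+1

s-inject₁ : (k : Fin n) → s k (inject₁ k) ≡ fsuc k
s-inject₁ k rewrite dec-true (inject₁ k ≟ᶠ inject₁ k) refl = refl

s-fsuc : (k : Fin n) → s k (fsuc k) ≡ inject₁ k
s-fsuc k rewrite dec-false (fsuc k ≟ᶠ inject₁ k) (inject₁≢fsuc k ∘ sym)
               | dec-true (fsuc k ≟ᶠ fsuc k) refl = refl

s-away : {k : Fin n} {i : Fin (suc n)} → i ≢ inject₁ k → i ≢ fsuc k → s k i ≡ i
s-away {k = k} {i} i≢k i≢k+1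
  rewrite dec-false (i ≟ᶠ inject₁ k) i≢k | dec-false (i ≟ᶠ fsuc k) i≢k+1 = refl

s-involutive : (k : Fin n) (i : Fin (suc n)) → s k (s k i) ≡ i
s-involutive k i with swapCase k i
... | left           = trans (cong (s k) (s-inject₁ k)) (s-fsuc k)
... | right          = trans (cong (s k) (s-fsuc k)) (s-inject₁ k)
... | away i≢k i≢k+1 = trans (cong (s k) (s-away i≢k i≢k+1)) (s-away i≢k i≢k+1)

s≗transpose : (k : Fin n) → s k ≗ PC.transpose (inject₁ k) (fsuc k)
s≗transpose k i with does (i ≟ᶠ inject₁ k)
... | true  = refl
... | false with does (i ≟ᶠ fsuc k)
...   | true  = refl
...   | false = refl

s-mono : (k : Fin n) {i j : Fin (suc n)} → i <ᶠ j → ¬ (i ≡ inject₁ k × j ≡ fsuc k) →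
         s k i <ᶠ s k j
s-mono k {i} {j} i<j notPair with swapCase k i | swapCase k j
... | left | left  = ⊥-elim (<-irrefl refl i<j)
... | left | right = ⊥-elim (notPair (refl , refl))
... | left | away j≢k j≢k+1 rewrite s-inject₁ k | s-away j≢k j≢k+1 =
  ≤∧≢⇒<ᶠ (inject₁<⇒fsuc≤ k i<j) (j≢k+1 ∘ sym)
... | right | left  = ⊥-elim (<-asym i<j (inject₁<fsuc k))
... | right | right = ⊥-elim (<-irrefl refl i<j)
... | right | away j≢k j≢k+1 rewrite s-fsuc k | s-away j≢k j≢k+1 = <-trans (inject₁<fsuc k) i<j
... | away i≢k i≢k+1 | left rewrite s-away i≢k i≢k+1 | s-inject₁ k = <-trans i<j (inject₁<fsuc k)
... | away i≢k i≢k+1 | right rewrite s-away i≢k i≢k+1 | s-fsuc k =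
  ≤∧≢⇒<ᶠ (<fsuc⇒≤inject₁ k i<j) i≢k
... | away i≢k i≢k+1 | away j≢k j≢k+1 rewrite s-away i≢k i≢k+1 | s-away j≢k j≢k+1 = i<j

s-reflects : (k : Fin n) {i j : Fin (suc n)} → s k i <ᶠ s k j → ¬ (i ≡ fsuc k × j ≡ inject₁ k) →
             i <ᶠ j
s-reflects k {i} {j} lt notPair =
  subst₂ _<ᶠ_ (s-involutive k i) (s-involutive k j) (s-mono k lt swapped)
  where
    swapped : ¬ (s k i ≡ inject₁ k × s k j ≡ fsuc k)
    swapped (e₁ , e₂) = notPair
      ( trans (sym (s-involutive k i)) (trans (cong (s k) e₁) (s-inject₁ k))
      , trans (sym (s-involutive k j)) (trans (cong (s k) e₂) (s-fsuc k)) )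

s-preserves-< : (k : Fin n) {i j : Fin (suc n)} →
                ¬ (i ≡ inject₁ k × j ≡ fsuc k) → ¬ (i ≡ fsuc k × j ≡ inject₁ k) →
                (s k i <ᶠ s k j) ⇔ (i <ᶠ j)
s-preserves-< k p q = mk⇔ (λ lt → s-reflects k lt q) (λ lt → s-mono k lt p)

s-fixes : {k : Fin n} {v : Fin (suc n)} → toℕ v ≢ toℕ k → toℕ v ≢ suc (toℕ k) → s k v ≡ v
s-fixes {k = k} p q =
  s-away (λ e → p (trans (cong toℕ e) (toℕ-inject₁ k))) (λ e → q (cong toℕ e))

s-fixes-left : {k : Fin n} {i : Fin (suc n)} → i <ᶠ inject₁ k → s k i ≡ i
s-fixes-left {k = k} i<k = s-away (λ e → <-irrefl (cong toℕ e) i<k)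
                                 (λ e → <-irrefl (cong toℕ e) (<-trans i<k (inject₁<fsuc k)))

s-fixes-right : {k : Fin n} {i : Fin (suc n)} → fsuc k <ᶠ i → s k i ≡ i
s-fixes-right {k = k} k<i = s-away (λ e → <-irrefl (cong toℕ (sym e)) (<-trans (inject₁<fsuc k) k<i))
                                   (λ e → <-irrefl (cong toℕ (sym e)) k<i)

s-fixed⇒away : {k : Fin n} {b : Fin (suc n)} → s k b ≡ b → b ≢ inject₁ k × b ≢ fsuc k
s-fixed⇒away {k = k} sb = (λ { refl → inject₁≢fsuc k (sym (trans (sym (s-inject₁ k)) sb)) })
                        , (λ { refl → inject₁≢fsuc k (trans (sym (s-fsuc k)) sb) })

s-below-fixed : {k : Fin n} {a b : Fin (suc n)} → s k b ≡ b → a <ᶠ b → s k a <ᶠ b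
s-below-fixed {k = k} {a} sb a<b = subst (s k a <ᶠ_) sb (s-mono k a<b (proj₂ (s-fixed⇒away sb) ∘ proj₂))

s-above-fixed : {k : Fin n} {b c : Fin (suc n)} → s k b ≡ b → b <ᶠ c → b <ᶠ s k c
s-above-fixed {k = k} {c = c} sb b<c = subst (_<ᶠ s k c) sb (s-mono k b<c (proj₁ (s-fixed⇒away sb) ∘ proj₁))

s-preserves-block : {z y : Fin n} → z ≢ y → (v : Fin (suc n)) →
                    (toℕ (s z v) ≤ toℕ y) ⇔ (toℕ v ≤ toℕ y)
s-preserves-block {z = z} {y} z≢y v with swapCase z v
... | left  rewrite s-inject₁ z | toℕ-inject₁ z = mk⇔ <⇒≤ (λ z≤y → ≤∧≢⇒< z≤y (z≢y ∘ toℕ-injective))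
... | right rewrite s-fsuc z    | toℕ-inject₁ z = mk⇔ (λ z≤y → ≤∧≢⇒< z≤y (z≢y ∘ toℕ-injective)) <⇒≤
... | away v≢z v≢z+1 rewrite s-away v≢z v≢z+1 = ⇔-id _

record Invertible (u : Perm n) : Set where
  field
    position    : Fin (suc n) → Fin (suc n)
    at-position : ∀ v → u (position v) ≡ v
    position-of : ∀ i → position (u i) ≡ i

  injective : Injective _≡_ _≡_ u
  injective {i} {j} e = trans (sym (position-of i)) (trans (cong position e) (position-of j))

open Invertible public

id-invertible : Invertible (idP {n})
id-invertible = record { position = λ v → v ; at-position = λ _ → refl ; position-of = λ _ → refl }

≈-invertible : {u w : Perm n} → u ≈ w → Invertible u → Invertible w
≈-invertible u≈w inv = record
  { position    = position inv
  ; at-position = λ v → trans (sym (u≈w _)) (at-position inv v)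
  ; position-of = λ i → trans (cong (position inv) (sym (u≈w i))) (position-of inv i) }

s∘-invertible : (k : Fin n) {u : Perm n} → Invertible u → Invertible (s k ∘ u)
s∘-invertible k inv = record
  { position    = position inv ∘ s k
  ; at-position = λ v → trans (cong (s k) (at-position inv (s k v))) (s-involutive k v)
  ; position-of = λ i → trans (cong (position inv) (s-involutive k _)) (position-of inv i) }

∘s-invertible : (k : Fin n) {u : Perm n} → Invertible u → Invertible (u ∘ s k)
∘s-invertible k {u} inv = record
  { position    = s k ∘ position inv
  ; at-position = λ v → trans (cong u (s-involutive k _)) (at-position inv v)
  ; position-of = λ i → trans (cong (s k) (position-of inv (s k i))) (s-involutive k i) }

prod-invertible : (ws : List (Fin n)) → Invertible (prod ws)
prod-invertible []       = id-invertible
prod-invertible (x ∷ ws) = s∘-invertible x (prod-invertible ws)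

prod-++ : (xs ys : List (Fin n)) → prod (xs ++ ys) ≈ (prod xs ∘ prod ys)
prod-++ []       ys i = refl
prod-++ (x ∷ xs) ys i = cong (s x) (prod-++ xs ys i)

Before : Perm n → Fin (suc n) → Fin (suc n) → Set
Before {n} u x y = Σ (Fin (suc n)) λ i → Σ (Fin (suc n)) λ j → i <ᶠ j × u i ≡ x × u j ≡ y

Before? : (u : Perm n) (x y : Fin (suc n)) → Dec (Before u x y)
Before? u x y = any? λ i → any? λ j → (toℕ i <? toℕ j) ×-dec (u i ≟ᶠ x) ×-dec (u j ≟ᶠ y)

Before-total : {u : Perm n} → Invertible u → ∀ {x y} → x ≢ y → Before u x y ⊎ Before u y x
Before-total {u = u} inv {x} {y} x≢y with <-cmp (toℕ (position inv x)) (toℕ (position inv y))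
... | tri< lt _ _ = inj₁ (_ , _ , lt , at-position inv x , at-position inv y)
... | tri≈ _ e _  = ⊥-elim (x≢y (trans (sym (at-position inv x))
                                   (trans (cong u (toℕ-injective e)) (at-position inv y))))
... | tri> _ _ gt = inj₂ (_ , _ , gt , at-position inv y , at-position inv x)

Before-asym : {u : Perm n} → Injective _≡_ _≡_ u → ∀ {x y} → Before u x y → ¬ Before u y x
Before-asym inj (i , j , i<j , ui , uj) (i′ , j′ , i′<j′ , ui′ , uj′)
  with inj (trans ui (sym uj′)) | inj (trans uj (sym ui′))
... | refl | refl = <-asym i<j i′<j′

Before-≈ : {u w : Perm n} → u ≈ w → ∀ {x y} → Before u x y → Before w x y
Before-≈ u≈w (i , j , i<j , ui , uj) = i , j , i<j , trans (sym (u≈w i)) ui , trans (sym (u≈w j)) uj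

Before⇒position< : {w : Perm n} (inv : Invertible w) {x y : Fin (suc n)} → Before w x y →
                   position inv x <ᶠ position inv y
Before⇒position< inv (i , j , i<j , refl , refl) =
  subst₂ _<ᶠ_ (sym (position-of inv i)) (sym (position-of inv j)) i<j

Before-s∘ : (x : Fin n) {u : Perm n} {v₁ v₂ : Fin (suc n)} → Before (s x ∘ u) v₁ v₂ →
            Before u (s x v₁) (s x v₂)
Before-s∘ x {u} (i , j , i<j , refl , refl) =
  i , j , i<j , sym (s-involutive x (u i)) , sym (s-involutive x (u j))

s∘-Before : (x : Fin n) {u : Perm n} {v₁ v₂ : Fin (suc n)} → Before u v₁ v₂ →
            Before (s x ∘ u) (s x v₁) (s x v₂)
s∘-Before x (i , j , i<j , refl , refl) = i , j , i<j , refl , refl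

_⊆Inv_ : Perm n → Perm n → Set
_⊆Inv_ {n} u w = ∀ {x y : Fin (suc n)} → x <ᶠ y → Before u y x → Before w y x

-- Inversions and the right weak order

𝟙< : ℕ → ℕ → ℕ
𝟙< m m′ with m <? m′
... | yes _ = 1
... | no _  = 0

𝟙<-yes : ∀ {m m′} → m < m′ → 𝟙< m m′ ≡ 1
𝟙<-yes {m} {m′} lt with m <? m′
... | yes _  = refl
... | no ¬lt = ⊥-elim (¬lt lt)

𝟙<-no : ∀ {m m′} → ¬ m < m′ → 𝟙< m m′ ≡ 0
𝟙<-no {m} {m′} ¬lt with m <? m′
... | yes lt = ⊥-elim (¬lt lt)
... | no _   = refl

𝟙<-cong : ∀ {m m′ k k′} → (m < m′ ⇔ k < k′) → 𝟙< m m′ ≡ 𝟙< k k′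
𝟙<-cong {m} {m′} iff with m <? m′
... | yes lt = sym (𝟙<-yes (Equivalence.to iff lt))
... | no ¬lt = sym (𝟙<-no (¬lt ∘ Equivalence.from iff))

𝟙<≤1 : ∀ m m′ → 𝟙< m m′ ≤ 1
𝟙<≤1 m m′ with m <? m′
... | yes _ = ≤-refl
... | no _  = z≤n

sum-mono-≤ : ∀ {m} {f g : Fin m → ℕ} → (∀ i → f i ≤ g i) → sum f ≤ sum g
sum-mono-≤ {zero}  f≤g = z≤n
sum-mono-≤ {suc m} f≤g = +-mono-≤ (f≤g _) (sum-mono-≤ {m} (f≤g ∘ fsuc))

sum-point : ∀ {m} {f g : Fin (suc m) → ℕ} (i₀ : Fin (suc m)) →
            (∀ i → i ≢ i₀ → f i ≡ g i) → f i₀ ≡ suc (g i₀) → sum f ≡ suc (sum g)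
sum-point {f = f} {g} i₀ agree bump = begin
  sum f                                         ≡⟨ sum-remove {i = i₀} f ⟩
  f i₀ + sum (f ∘ punchIn i₀)                   ≡⟨ cong₂ _+_ bump (sum-cong-≗ elsewhere) ⟩
  suc (g i₀ + sum (g ∘ punchIn i₀))             ≡⟨ cong suc (sym (sum-remove {i = i₀} g)) ⟩
  suc (sum g)                                   ∎
  where
    open ≡-Reasoning
    elsewhere : (f ∘ punchIn i₀) ≗ (g ∘ punchIn i₀)
    elsewhere j = agree (punchIn i₀ j) (punchInᵢ≢i i₀ j)

sum-∘s : (k : Fin n) (f : Fin (suc n) → ℕ) → sum (f ∘ s k) ≡ sum f
sum-∘s k f = trans (sum-cong-≗ (cong f ∘ s≗transpose k)) (sym (sum-permute f (transpose (inject₁ k) (fsuc k))))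

Σ₂ : (Fin (suc n) → Fin (suc n) → ℕ) → ℕ
Σ₂ {n} F = ∑[ i < suc n ] ∑[ j < suc n ] F i j

Σ₂-cong : {F G : Fin (suc n) → Fin (suc n) → ℕ} → (∀ i j → F i j ≡ G i j) → Σ₂ F ≡ Σ₂ G
Σ₂-cong F≡G = sum-cong-≗ λ i → sum-cong-≗ (F≡G i)

Σ₂-∘s : (k : Fin n) (F : Fin (suc n) → Fin (suc n) → ℕ) → Σ₂ (λ i j → F (s k i) (s k j)) ≡ Σ₂ F
Σ₂-∘s k F = trans (sum-cong-≗ λ i → sum-∘s k (F (s k i))) (sum-∘s k (λ i → sum (F i)))

Σ₂-point : {F G : Fin (suc n) → Fin (suc n) → ℕ} (i₀ j₀ : Fin (suc n)) →
           (∀ i j → ¬ (i ≡ i₀ × j ≡ j₀) → F i j ≡ G i j) → F i₀ j₀ ≡ suc (G i₀ j₀) →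
           Σ₂ F ≡ suc (Σ₂ G)
Σ₂-point i₀ j₀ agree bump =
  sum-point i₀ (λ i i≢i₀ → sum-cong-≗ λ j → agree i j (i≢i₀ ∘ proj₁))
               (sum-point j₀ (λ j j≢j₀ → agree i₀ j (j≢j₀ ∘ proj₂)) bump)

inversion : Perm n → Fin (suc n) → Fin (suc n) → ℕ
inversion u i j = 𝟙< (toℕ i) (toℕ j) * 𝟙< (toℕ (u j)) (toℕ (u i))

inversions : Perm n → ℕ
inversions u = Σ₂ (inversion u)

inversions-cong : {u w : Perm n} → u ≈ w → inversions u ≡ inversions w
inversions-cong u≈w = Σ₂-cong λ i j →
  cong₂ (λ x y → 𝟙< (toℕ i) (toℕ j) * 𝟙< (toℕ x) (toℕ y)) (u≈w j) (u≈w i)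

inversions-id : inversions (idP {n}) ≡ 0
inversions-id {n} = trans (Σ₂-cong {n} none) Σ₂-zero
  where
    none : ∀ i j → inversion idP i j ≡ 0
    none i j with toℕ i <? toℕ j
    ... | yes i<j = cong (1 *_) (𝟙<-no (<-asym i<j))
    ... | no _    = refl
    Σ₂-zero : Σ₂ {n} (λ _ _ → 0) ≡ 0
    Σ₂-zero = trans (sum-cong-≗ {suc n} {λ _ → sum {suc n} (λ _ → 0)} {λ _ → 0}
                                λ _ → sum-replicate-zero (suc n))
                    (sum-replicate-zero (suc n))

maxInversions : ℕ → ℕ
maxInversions n = Σ₂ {n} (λ _ _ → 1)

inversions≤max : (u : Perm n) → inversions u ≤ maxInversions n
inversions≤max {n} u = sum-mono-≤ {suc n} λ i → sum-mono-≤ {suc n} λ j →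
  *-mono-≤ (𝟙<≤1 (toℕ i) (toℕ j)) (𝟙<≤1 (toℕ (u j)) (toℕ (u i)))

Ascent : Perm n → Fin n → Set
Ascent u b = u (inject₁ b) <ᶠ u (fsuc b)

Descent : Perm n → Fin n → Set
Descent u b = u (fsuc b) <ᶠ u (inject₁ b)

ascent-or-descent : {u : Perm n} → Injective _≡_ _≡_ u → (b : Fin n) → Ascent u b ⊎ Descent u b
ascent-or-descent {u = u} inj b with <-cmp (toℕ (u (inject₁ b))) (toℕ (u (fsuc b)))
... | tri< asc _ _ = inj₁ asc
... | tri≈ _ e _   = ⊥-elim (inject₁≢fsuc b (inj (toℕ-injective e)))
... | tri> _ _ dsc = inj₂ dsc

inversions-∘s-ascent : (u : Perm n) (b : Fin n) → Ascent u b →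
                       inversions (u ∘ s b) ≡ suc (inversions u)
inversions-∘s-ascent {n} u b asc = begin
  inversions (u ∘ s b)            ≡⟨ Σ₂-cong unswap ⟩
  Σ₂ (λ i j → H (s b i) (s b j))  ≡⟨ Σ₂-∘s b H ⟩
  Σ₂ H                            ≡⟨ Σ₂-point (fsuc b) (inject₁ b) agree bump ⟩
  suc (inversions u)              ∎
  where
    open ≡-Reasoning
    H : Fin (suc n) → Fin (suc n) → ℕ
    H i j = 𝟙< (toℕ (s b i)) (toℕ (s b j)) * 𝟙< (toℕ (u j)) (toℕ (u i))
    unswap : ∀ i j → inversion (u ∘ s b) i j ≡ H (s b i) (s b j)
    unswap i j = cong₂ (λ x y → 𝟙< (toℕ x) (toℕ y) * 𝟙< (toℕ (u (s b j))) (toℕ (u (s b i))))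
                       (sym (s-involutive b i)) (sym (s-involutive b j))
    agree : ∀ i j → ¬ (i ≡ fsuc b × j ≡ inject₁ b) → H i j ≡ inversion u i j
    agree i j notBump with (i ≟ᶠ inject₁ b) ×-dec (j ≟ᶠ fsuc b)
    ... | yes (refl , refl)
      rewrite s-inject₁ b | s-fsuc b
            | 𝟙<-no (<-asym (inject₁<fsuc b)) | 𝟙<-no (<-asym asc)
      = sym (*-zeroʳ (𝟙< (toℕ (inject₁ b)) (toℕ (fsuc b))))
    ... | no notAsc = cong (_* 𝟙< (toℕ (u j)) (toℕ (u i))) (𝟙<-cong (s-preserves-< b notAsc notBump))
    bump : H (fsuc b) (inject₁ b) ≡ suc (inversion u (fsuc b) (inject₁ b))
    bump rewrite s-fsuc b | s-inject₁ b
               | 𝟙<-yes (inject₁<fsuc b) | 𝟙<-yes asc | 𝟙<-no (<-asym (inject₁<fsuc b)) = refl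

inversions-∘s-descent : (u : Perm n) (b : Fin n) → Descent u b →
                        suc (inversions (u ∘ s b)) ≡ inversions u
inversions-∘s-descent u b dsc = begin
  suc (inversions (u ∘ s b))  ≡⟨ inversions-∘s-ascent (u ∘ s b) b asc ⟨
  inversions (u ∘ s b ∘ s b)  ≡⟨ inversions-cong (cong u ∘ s-involutive b) ⟩
  inversions u                ∎
  where
    open ≡-Reasoning
    asc : Ascent (u ∘ s b) b
    asc = subst₂ (λ x y → u x <ᶠ u y) (sym (s-inject₁ b)) (sym (s-fsuc b)) dsc

inversions-s∘-ascent : (x : Fin n) {u : Perm n} → Injective _≡_ _≡_ u →
                       ∀ {p q} → p <ᶠ q → u p ≡ inject₁ x → u q ≡ fsuc x →
                       inversions (s x ∘ u) ≡ suc (inversions u)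
inversions-s∘-ascent x {u} inj {p} {q} p<q up uq = Σ₂-point p q agree bump
  where
    agree : ∀ i j → ¬ (i ≡ p × j ≡ q) → inversion (s x ∘ u) i j ≡ inversion u i j
    agree i j notBump with (u j ≟ᶠ inject₁ x) ×-dec (u i ≟ᶠ fsuc x)
    ... | yes (ujx , uix) with inj (trans ujx (sym up)) | inj (trans uix (sym uq))
    ...   | refl | refl rewrite 𝟙<-no (<-asym p<q) = refl
    agree i j notBump | no notAsc =
      cong (𝟙< (toℕ i) (toℕ j) *_) (𝟙<-cong (s-preserves-< x notAsc (notBump ∘ swapped)))
      where swapped = λ (e₁ , e₂) → inj (trans e₂ (sym up)) , inj (trans e₁ (sym uq))
    bump : inversion (s x ∘ u) p q ≡ suc (inversion u p q)
    bump rewrite up | uq | s-fsuc x | s-inject₁ x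
               | 𝟙<-yes p<q | 𝟙<-yes (inject₁<fsuc x) | 𝟙<-no (<-asym (inject₁<fsuc x)) = refl

inversions-∘s-≤ : {u : Perm n} → Injective _≡_ _≡_ u → (b : Fin n) →
                  inversions (u ∘ s b) ≤ suc (inversions u)
inversions-∘s-≤ {u = u} inj b with ascent-or-descent inj b
... | inj₁ asc = ≤-reflexive (inversions-∘s-ascent u b asc)
... | inj₂ dsc = m<n⇒m≤1+n (≤-reflexive (inversions-∘s-descent u b dsc))

inversions-∘prod-≤ : {u : Perm n} → Invertible u → (bs : List (Fin n)) →
                     inversions (u ∘ prod bs) ≤ inversions u + length bs
inversions-∘prod-≤ {u = u} inv []       = ≤-reflexive (sym (+-identityʳ (inversions u)))
inversions-∘prod-≤ {u = u} inv (b ∷ bs) = begin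
  inversions (u ∘ s b ∘ prod bs)    ≤⟨ inversions-∘prod-≤ (∘s-invertible b inv) bs ⟩
  inversions (u ∘ s b) + length bs  ≤⟨ +-monoˡ-≤ (length bs) (inversions-∘s-≤ (injective inv) b) ⟩
  suc (inversions u) + length bs    ≡⟨ +-suc (inversions u) (length bs) ⟨
  inversions u + length (b ∷ bs)    ∎
  where open ≤-Reasoning

inversions-prod-≤ : (ws : List (Fin n)) → inversions (prod ws) ≤ length ws
inversions-prod-≤ {n} ws = subst (λ k → inversions (prod ws) ≤ k + length ws) (inversions-id {n})
                                 (inversions-∘prod-≤ id-invertible ws)

ascent-⊆Inv : {u : Perm n} (b : Fin n) → Ascent u b → u ⊆Inv (u ∘ s b)
ascent-⊆Inv {u = u} b asc x<y (i , j , i<j , ui , uj)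
  with (i ≟ᶠ inject₁ b) ×-dec (j ≟ᶠ fsuc b)
... | yes (refl , refl) = ⊥-elim (<-asym x<y (subst₂ _<ᶠ_ ui uj asc))
... | no notAsc = s b i , s b j , s-mono b i<j notAsc
                , trans (cong u (s-involutive b i)) ui , trans (cong u (s-involutive b j)) uj

Before-∘s : {u : Perm n} (b : Fin n) {x y : Fin (suc n)} → Before (u ∘ s b) y x →
            Before u y x ⊎ (y ≡ u (fsuc b) × x ≡ u (inject₁ b))
Before-∘s {u = u} b (i , j , i<j , ui , uj) with (i ≟ᶠ inject₁ b) ×-dec (j ≟ᶠ fsuc b)
... | yes (refl , refl) = inj₂ (trans (sym ui) (cong u (s-inject₁ b)) , trans (sym uj) (cong u (s-fsuc b)))
... | no notAsc = inj₁ (s b i , s b j , s-mono b i<j notAsc , ui , uj)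

additive⇒⊆Inv : {u : Perm n} → Invertible u → (bs : List (Fin n)) →
                inversions (u ∘ prod bs) ≡ inversions u + length bs → u ⊆Inv (u ∘ prod bs)
additive⇒⊆Inv inv [] _ x<y bef = bef
additive⇒⊆Inv {u = u} inv (b ∷ bs) additive with ascent-or-descent (injective inv) b
... | inj₁ asc = λ x<y → additive⇒⊆Inv (∘s-invertible b inv) bs additive′ x<y ∘ ascent-⊆Inv b asc x<y
  where
    additive′ : inversions (u ∘ s b ∘ prod bs) ≡ inversions (u ∘ s b) + length bs
    additive′ = begin
      inversions (u ∘ s b ∘ prod bs)    ≡⟨ additive ⟩
      inversions u + suc (length bs)    ≡⟨ +-suc (inversions u) (length bs) ⟩
      suc (inversions u) + length bs    ≡⟨ cong (_+ length bs) (inversions-∘s-ascent u b asc) ⟨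
      inversions (u ∘ s b) + length bs  ∎
      where open ≡-Reasoning
... | inj₂ dsc = ⊥-elim (<⇒≱ tooMany (inversions-∘prod-≤ (∘s-invertible b inv) bs))
  where
    tooMany : inversions (u ∘ s b) + length bs < inversions (u ∘ s b ∘ prod bs)
    tooMany = begin-strict
      inversions (u ∘ s b) + length bs        <⟨ +-monoʳ-< (inversions (u ∘ s b)) (n<1+n (length bs)) ⟩
      inversions (u ∘ s b) + suc (length bs)  <⟨ +-monoˡ-< (suc (length bs))
                                                     (≤-reflexive (inversions-∘s-descent u b dsc)) ⟩
      inversions u + suc (length bs)          ≡⟨ additive ⟨
      inversions (u ∘ s b ∘ prod bs)          ∎
      where open ≤-Reasoning

adjacent-increasing⇒id : (h : Perm n) → (∀ b → h (inject₁ b) <ᶠ h (fsuc b)) → ∀ i → h i ≡ i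
adjacent-increasing⇒id {n} h inc i = toℕ-injective (≤-antisym (below i) (above i))
  where
    above : ∀ i → toℕ i ≤ toℕ (h i)
    above = <-weakInduction (λ i → toℕ i ≤ toℕ (h i)) z≤n λ b ih →
      ≤-trans (s≤s (subst (_≤ toℕ (h (inject₁ b))) (toℕ-inject₁ b) ih)) (inc b)
    below : ∀ i → toℕ (h i) ≤ toℕ i
    below = >-weakInduction (λ i → toℕ (h i) ≤ toℕ i)
      (subst (toℕ (h (fromℕ n)) ≤_) (sym (toℕ-fromℕ n)) (toℕ≤pred[n] (h (fromℕ n))))
      λ b ih → subst (toℕ (h (inject₁ b)) ≤_) (sym (toℕ-inject₁ b)) (≤-pred (≤-trans (inc b) ih))

id-⊆Inv : (w : Perm n) → idP ⊆Inv w
id-⊆Inv w x<y (i , j , i<j , refl , refl) = ⊥-elim (<-asym x<y i<j)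

InvertedAscent : Perm n → Perm n → Set
InvertedAscent {n} u w = Σ (Fin n) λ b → Ascent u b × Before w (u (fsuc b)) (u (inject₁ b))

invertedAscent? : (u w : Perm n) → Dec (InvertedAscent u w)
invertedAscent? u w =
  any? λ b → (toℕ (u (inject₁ b)) <? toℕ (u (fsuc b))) ×-dec Before? w (u (fsuc b)) (u (inject₁ b))

no-inverted-ascent⇒≈ : {u w : Perm n} → Invertible u → Invertible w → u ⊆Inv w →
                       ¬ InvertedAscent u w → u ≈ w
no-inverted-ascent⇒≈ {u = u} {w} invu invw u⊆w noInverted i =
  trans (sym (at-position invw (u i))) (cong w (adjacent-increasing⇒id (position invw ∘ u) inc i))
  where
    inOrder : ∀ b → Before w (u (inject₁ b)) (u (fsuc b))
    inOrder b with ascent-or-descent (injective invu) b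
    ... | inj₂ dsc = u⊆w dsc (inject₁ b , fsuc b , inject₁<fsuc b , refl , refl)
    ... | inj₁ asc with Before-total invw (λ e → inject₁≢fsuc b (injective invu e))
    ...   | inj₁ bef = bef
    ...   | inj₂ bef = ⊥-elim (noInverted (b , asc , bef))
    inc : ∀ b → position invw (u (inject₁ b)) <ᶠ position invw (u (fsuc b))
    inc b = Before⇒position< invw (inOrder b)

-- Each step right-multiplies u by an ascent that w inverts, adding one inversion, so the
-- fuel bounds the recursion.
⊆Inv⇒word-bounded : ∀ fuel {u w : Perm n} → maxInversions n ≤ inversions u + fuel →
                    Invertible u → Invertible w → u ⊆Inv w →
                    Σ (List (Fin n)) λ bs → ((u ∘ prod bs) ≈ w) × (inversions u + length bs ≡ inversions w)
⊆Inv⇒word-bounded {n} fuel {u} {w} bound invu invw u⊆w with invertedAscent? u w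
... | no noInverted = [] , u≈w , trans (+-identityʳ (inversions u)) (inversions-cong u≈w)
  where u≈w = no-inverted-ascent⇒≈ invu invw u⊆w noInverted
... | yes (b , asc , bef) with fuel
...   | zero = ⊥-elim (<⇒≱ (≤-<-trans (≤-trans bound (≤-reflexive (+-identityʳ _)))
                              (≤-reflexive (sym (inversions-∘s-ascent u b asc))))
                          (inversions≤max (u ∘ s b)))
...   | suc fuel′ with ⊆Inv⇒word-bounded fuel′ bound′ (∘s-invertible b invu) invw u∘b⊆w
  where
    bound′ : maxInversions n ≤ inversions (u ∘ s b) + fuel′
    bound′ = ≤-trans bound (≤-reflexive (trans (+-suc _ fuel′)
               (cong (_+ fuel′) (sym (inversions-∘s-ascent u b asc)))))
    u∘b⊆w : (u ∘ s b) ⊆Inv w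
    u∘b⊆w x<y bef′ with Before-∘s b bef′
    ... | inj₁ old          = u⊆w x<y old
    ... | inj₂ (refl , refl) = bef
... | bs , u∘b∘bs≈w , count = b ∷ bs , u∘b∘bs≈w , (begin
  inversions u + suc (length bs)    ≡⟨ +-suc (inversions u) (length bs) ⟩
  suc (inversions u) + length bs    ≡⟨ cong (_+ length bs) (inversions-∘s-ascent u b asc) ⟨
  inversions (u ∘ s b) + length bs  ≡⟨ count ⟩
  inversions w                      ∎)
  where open ≡-Reasoning

⊆Inv⇒word : {u w : Perm n} → Invertible u → Invertible w → u ⊆Inv w →
            Σ (List (Fin n)) λ bs → ((u ∘ prod bs) ≈ w) × (inversions u + length bs ≡ inversions w)
⊆Inv⇒word {n} {u} = ⊆Inv⇒word-bounded (maxInversions n) (m≤n+m (maxInversions n) (inversions u))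

reduced⇒inversions : {ws : List (Fin n)} {w : Perm n} → Reduced ws w → inversions w ≡ length ws
reduced⇒inversions {n} {ws} {w} (prod≈w , minimal) =
  ≤-antisym (subst (_≤ length ws) (inversions-cong {n} prod≈w) (inversions-prod-≤ ws))
            (shortest (⊆Inv⇒word id-invertible (≈-invertible {n} prod≈w (prod-invertible ws)) (id-⊆Inv w)))
  where
    shortest : Σ (List (Fin n)) (λ bs → (prod bs ≈ w) × (inversions (idP {n}) + length bs ≡ inversions w)) →
               length ws ≤ inversions w
    shortest (bs , prod≈w′ , count) =
      ≤-trans (minimal bs prod≈w′) (≤-reflexive (trans (cong (_+ length bs) (sym (inversions-id {n}))) count))

inversions⇒reduced : {ws : List (Fin n)} {w : Perm n} → prod ws ≈ w → inversions w ≡ length ws →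
                     Reduced ws w
inversions⇒reduced {n} prod≈w count = prod≈w , λ vs prod≈w′ →
  ≤-trans (≤-reflexive (sym count)) (subst (_≤ length vs) (inversions-cong {n} prod≈w′) (inversions-prod-≤ vs))

≤R⇒⊆Inv : {u w : Perm n} → u ≤R w → u ⊆Inv w
≤R⇒⊆Inv {n} {u} {w} (as , bs , red-u , red-w) x<y =
  Before-≈ u∘bs≈w ∘ additive⇒⊆Inv (≈-invertible (proj₁ red-u) (prod-invertible as)) bs additive x<y
  where
    open ≡-Reasoning
    u∘bs≈w : (u ∘ prod bs) ≈ w
    u∘bs≈w i = trans (sym (proj₁ red-u (prod bs i))) (trans (sym (prod-++ as bs i)) (proj₁ red-w i))
    additive : inversions (u ∘ prod bs) ≡ inversions u + length bs
    additive = begin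
      inversions (u ∘ prod bs)  ≡⟨ inversions-cong u∘bs≈w ⟩
      inversions w              ≡⟨ reduced⇒inversions {n} {as ++ bs} {w} red-w ⟩
      length (as ++ bs)         ≡⟨ length-++ as ⟩
      length as + length bs     ≡⟨ cong (_+ length bs) (reduced⇒inversions {n} {as} {u} red-u) ⟨
      inversions u + length bs  ∎

⊆Inv⇒≤R : {as : List (Fin n)} {u w : Perm n} → Reduced as u → Invertible w → u ⊆Inv w → u ≤R w
⊆Inv⇒≤R {n} {as} {u} {w} red-u inv-w u⊆w =
  extend (⊆Inv⇒word (≈-invertible (proj₁ red-u) (prod-invertible as)) inv-w u⊆w)
  where
    extend : Σ (List (Fin n)) (λ bs → ((u ∘ prod bs) ≈ w) × (inversions u + length bs ≡ inversions w)) →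
             u ≤R w
    extend (bs , u∘bs≈w , count) =
      as , bs , red-u , inversions⇒reduced {n} {as ++ bs} {w}
        (λ i → trans (prod-++ as bs i) (trans (proj₁ red-u (prod bs i)) (u∘bs≈w i))) (begin
        inversions w              ≡⟨ count ⟨
        inversions u + length bs  ≡⟨ cong (_+ length bs) (reduced⇒inversions {n} {as} {u} red-u) ⟩
        length as + length bs     ≡⟨ length-++ as ⟨
        length (as ++ bs)         ∎)
      where open ≡-Reasoning

reduced-cons : (x : Fin n) (ws : List (Fin n)) → inversions (prod (x ∷ ws)) ≡ suc (length ws) →
               inversions (prod ws) ≡ length ws × Before (prod (x ∷ ws)) (fsuc x) (inject₁ x)
reduced-cons x ws count with Before-total (prod-invertible ws) (inject₁≢fsuc x)
... | inj₁ (p , q , p<q , up , uq) =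
  suc-injective (trans (sym (inversions-s∘-ascent x (injective (prod-invertible ws)) p<q up uq)) count)
  , p , q , p<q , trans (cong (s x) up) (s-inject₁ x) , trans (cong (s x) uq) (s-fsuc x)
... | inj₂ bef = ⊥-elim (<⇒≱ tooMany (inversions-prod-≤ ws))
  where
    w = prod (x ∷ ws)
    tooMany : length ws < inversions (prod ws)
    tooMany with s∘-Before x bef
    ... | p , q , p<q , up , uq = begin-strict
      length ws                ≤⟨ n≤1+n (length ws) ⟩
      suc (length ws)          ≡⟨ count ⟨
      inversions w             <⟨ n<1+n (inversions w) ⟩
      suc (inversions w)       ≡⟨ inversions-s∘-ascent x (injective (prod-invertible (x ∷ ws))) p<q
                                    (trans up (s-fsuc x)) (trans uq (s-inject₁ x)) ⟨
      inversions (s x ∘ w)     ≡⟨ inversions-cong (s-involutive x ∘ prod ws) ⟩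
      inversions (prod ws)     ∎
      where open ≤-Reasoning

-- Cyclic words avoid barred patterns

-- A word read off the cyclic queue cl: the letter at the front is either written down and
-- moved to the back, or discarded for good.  Sorting words of c-sortable permutations have
-- this shape, read off c = a₁ ⋯ aₙ.
data CyclicWord {n} : List (Fin n) → List (Fin n) → Set where
  []   : ∀ {cl} → CyclicWord cl []
  use  : ∀ {x cl ws} → CyclicWord (cl ++ x ∷ []) ws → CyclicWord (x ∷ cl) (x ∷ ws)
  skip : ∀ {x cl ws} → CyclicWord cl ws → CyclicWord (x ∷ cl) ws

CyclicWord-⊆ : {cl ws : List (Fin n)} → CyclicWord cl ws → ∀ {z} → z ∈ ws → z ∈ cl
CyclicWord-⊆ (use word) (here refl) = here refl
CyclicWord-⊆ (use {cl = cl} word) (there z∈ws) with ∈-++⁻ cl (CyclicWord-⊆ word z∈ws)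
... | inj₁ z∈cl        = there z∈cl
... | inj₂ (here refl) = here refl
CyclicWord-⊆ (skip word) z∈ws = there (CyclicWord-⊆ word z∈ws)

data EarlierIn {A : Set} : List A → A → A → Set where
  here  : ∀ {y z l} → z ∈ l → EarlierIn (y ∷ l) y z
  there : ∀ {u y z l} → EarlierIn l y z → EarlierIn (u ∷ l) y z

EarlierIn-∈ : {A : Set} {l : List A} {y z : A} → EarlierIn l y z → y ∈ l × z ∈ l
EarlierIn-∈ (here z∈l)  = here refl , there z∈l
EarlierIn-∈ (there ear) = there (proj₁ (EarlierIn-∈ ear)) , there (proj₂ (EarlierIn-∈ ear))

EarlierIn-++ : {A : Set} {l : List A} {x y z : A} → EarlierIn l y z → EarlierIn (l ++ x ∷ []) y z
EarlierIn-++ (here z∈l)  = here (∈-++⁺ˡ z∈l)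
EarlierIn-++ (there ear) = there (EarlierIn-++ ear)

EarlierIn-last : {A : Set} {l : List A} {x y : A} → y ∈ l → EarlierIn (l ++ x ∷ []) y x
EarlierIn-last {l = _ ∷ l} (here refl) = here (∈-++⁺ʳ l (here refl))
EarlierIn-last (there y∈l)             = there (EarlierIn-last y∈l)

-- In the paper's numbering the value b is the number b + 1, y is s_{b+1} and x is s_b;
-- b + 1 is upper-barred when s_{b+1} comes before s_b in c, lower-barred otherwise.
UpperBarredIn : List (Fin n) → Fin (suc n) → Set
UpperBarredIn {n} cl b = Σ (Fin n) λ y → Σ (Fin n) λ x →
  toℕ y ≡ toℕ b × suc (toℕ x) ≡ toℕ b × EarlierIn cl y x

LowerBarredIn : List (Fin n) → Fin (suc n) → Set
LowerBarredIn {n} cl b = Σ (Fin n) λ y → Σ (Fin n) λ x →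
  toℕ y ≡ toℕ b × suc (toℕ x) ≡ toℕ b × EarlierIn cl x y

Avoids231 : List (Fin n) → Perm n → Set
Avoids231 {n} cl w = ∀ {a b c : Fin (suc n)} → a <ᶠ b → b <ᶠ c → UpperBarredIn cl b →
                     Before w b c → Before w c a → ⊥

Avoids312 : List (Fin n) → Perm n → Set
Avoids312 {n} cl w = ∀ {a b c : Fin (suc n)} → a <ᶠ b → b <ᶠ c → LowerBarredIn cl b →
                     Before w c a → Before w a b → ⊥

prod-preserves-block : {y : Fin n} (ws : List (Fin n)) → y ∉ ws → ∀ v →
                       (toℕ (prod ws v) ≤ toℕ y) ⇔ (toℕ v ≤ toℕ y)
prod-preserves-block []       y∉ws v = ⇔-id _
prod-preserves-block (z ∷ ws) y∉ws v =
  prod-preserves-block ws (y∉ws ∘ there) v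
  ⇔-∘ s-preserves-block (λ z≡y → y∉ws (here (sym z≡y))) (prod ws v)

no-crossing : {y : Fin n} (ws : List (Fin n)) → y ∉ ws → ∀ {a c : Fin (suc n)} →
              toℕ a ≤ toℕ y → toℕ y < toℕ c → ¬ Before (prod ws) c a
no-crossing {y = y} ws y∉ws a≤y y<c (i , j , i<j , refl , refl) with toℕ i ≤? toℕ y
... | yes i≤y = <⇒≱ y<c (Equivalence.from (prod-preserves-block ws y∉ws i) i≤y)
... | no  i≰y = <⇒≱ (<-trans (≰⇒> i≰y) i<j) (Equivalence.to (prod-preserves-block ws y∉ws j) a≤y)

id-avoids : {cl : List (Fin n)} → Avoids231 cl idP × Avoids312 cl idP
id-avoids = (λ { a<b b<c _ _ (_ , _ , c<a , refl , refl) → <-asym (<-trans a<b b<c) c<a })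
          , (λ { a<b b<c _ (_ , _ , c<a , refl , refl) _ → <-asym (<-trans a<b b<c) c<a })

skip-avoids : {x : Fin n} {cl ws : List (Fin n)} → x ∉ ws →
              Avoids231 cl (prod ws) × Avoids312 cl (prod ws) →
              Avoids231 (x ∷ cl) (prod ws) × Avoids312 (x ∷ cl) (prod ws)
skip-avoids {x = x} {ws = ws} x∉ws (upper , lower) = upper′ , lower′
  where
    upper′ : Avoids231 (x ∷ _) (prod ws)
    upper′ {a} {b} {c} a<b b<c (_ , _ , x≡b , _ , here _) _ ca =
      no-crossing ws x∉ws (<⇒≤ (subst (toℕ a <_) (sym x≡b) a<b)) (subst (_< toℕ c) (sym x≡b) b<c) ca
    upper′ a<b b<c (y , z , y≡b , z+1≡b , there ear) = upper a<b b<c (y , z , y≡b , z+1≡b , ear)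
    lower′ : Avoids312 (x ∷ _) (prod ws)
    lower′ {a} {b} {c} a<b b<c (_ , _ , _ , x+1≡b , here _) ca _ =
      no-crossing ws x∉ws (≤-pred (subst (toℕ a <_) (sym x+1≡b) a<b))
                  (<-trans (subst (toℕ x <_) x+1≡b (n<1+n (toℕ x))) b<c) ca
    lower′ a<b b<c (y , z , y≡b , z+1≡b , there ear) = lower a<b b<c (y , z , y≡b , z+1≡b , ear)

predecessor : (x : Fin n) → 0 < toℕ x → Σ (Fin n) λ ℓ → suc (toℕ ℓ) ≡ toℕ x
predecessor (fsuc ℓ) _ = inject₁ ℓ , cong suc (toℕ-inject₁ ℓ)

successor : (x : Fin n) → suc (toℕ x) < n → Σ (Fin n) λ ℓ → toℕ ℓ ≡ suc (toℕ x)
successor x x+1<n = fromℕ< x+1<n , toℕ-fromℕ< x+1<n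

module UseStep {x : Fin n} {cl ws : List (Fin n)}
  (word : CyclicWord (cl ++ x ∷ []) ws) (x∉cl : x ∉ cl)
  (ih : Avoids231 (cl ++ x ∷ []) (prod ws) × Avoids312 (cl ++ x ∷ []) (prod ws))
  (x+1≺x : Before (prod (x ∷ ws)) (fsuc x) (inject₁ x))
  where

  private
    w : Perm n
    w = prod (x ∷ ws)

    x⊀x+1 : ¬ Before w (inject₁ x) (fsuc x)
    x⊀x+1 bef = Before-asym (injective (prod-invertible (x ∷ ws))) bef x+1≺x

    unused : {ℓ : Fin n} → toℕ ℓ ≢ toℕ x → ℓ ∉ cl → ℓ ∉ ws
    unused ℓ≢x ℓ∉cl ℓ∈ws with ∈-++⁻ cl (CyclicWord-⊆ word ℓ∈ws)
    ... | inj₁ ℓ∈cl        = ℓ∉cl ℓ∈cl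
    ... | inj₂ (here refl) = ℓ≢x refl

    fixes-tail-barred : {y z : Fin n} {b : Fin (suc n)} → y ∈ cl → z ∈ cl →
                        toℕ y ≡ toℕ b → suc (toℕ z) ≡ toℕ b → s x b ≡ b
    fixes-tail-barred {y} {z} y∈cl z∈cl y≡b z+1≡b = s-fixes
      (λ b≡x → x∉cl (subst (_∈ cl) (toℕ-injective (trans y≡b b≡x)) y∈cl))
      (λ b≡x+1 → x∉cl (subst (_∈ cl) (toℕ-injective (suc-injective (trans z+1≡b b≡x+1))) z∈cl))

  -- With b = x, the pattern b c a moves under s_x to (x+1) c a in prod ws; it is
  -- excluded there either by the induction hypothesis (if the letter x+1 is
  -- still in the queue, it now bars x+1) or because x+1 is never used.
  upper-head : ∀ {a b c : Fin (suc n)} → a <ᶠ b → b <ᶠ c → toℕ x ≡ toℕ b →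
               Before w b c → Before w c a → ⊥
  upper-head {a} {b} {c} a<b b<c x≡b bc ca with toℕ c ≟ suc (toℕ x)
  ... | yes c≡x+1 = x⊀x+1 (subst₂ (Before w) (toℕ-injective (trans (sym x≡b) (sym (toℕ-inject₁ x))))
                                             (toℕ-injective c≡x+1) bc)
  ... | no c≢x+1 = via (successor x (<-≤-trans x+1<c (toℕ≤pred[n] c)))
    where
      a<x : toℕ a < toℕ x
      a<x = subst (toℕ a <_) (sym x≡b) a<b
      x+1<c : suc (toℕ x) < toℕ c
      x+1<c = ≤∧≢⇒< (subst (_< toℕ c) (sym x≡b) b<c) (c≢x+1 ∘ sym)
      bc′ : Before (prod ws) (fsuc x) c
      bc′ = subst₂ (Before (prod ws))
              (trans (cong (s x) (toℕ-injective (trans (sym x≡b) (sym (toℕ-inject₁ x))))) (s-inject₁ x))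
              (s-fixes (≢-sym (<⇒≢ (<-trans (n<1+n (toℕ x)) x+1<c))) (≢-sym (<⇒≢ x+1<c)))
              (Before-s∘ x bc)
      ca′ : Before (prod ws) c a
      ca′ = subst₂ (Before (prod ws))
              (s-fixes (≢-sym (<⇒≢ (<-trans (n<1+n (toℕ x)) x+1<c))) (≢-sym (<⇒≢ x+1<c)))
              (s-fixes (<⇒≢ a<x) (<⇒≢ (<-trans a<x (n<1+n (toℕ x)))))
              (Before-s∘ x ca)
      via : Σ (Fin n) (λ ℓ → toℕ ℓ ≡ suc (toℕ x)) → ⊥
      via (ℓ , ℓ≡x+1) with Any.any? (ℓ ≟ᶠ_) cl
      ... | yes ℓ∈cl = proj₁ ih (<-trans a<x (n<1+n (toℕ x))) x+1<c
                                (ℓ , x , ℓ≡x+1 , refl , EarlierIn-last ℓ∈cl) bc′ ca′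
      ... | no ℓ∉cl  = no-crossing ws (unused (λ e → <-irrefl (trans (sym e) ℓ≡x+1) (n<1+n (toℕ x))) ℓ∉cl)
                                  (subst (toℕ a ≤_) (sym ℓ≡x+1) (<⇒≤ (<-trans a<x (n<1+n (toℕ x)))))
                                  (subst (_< toℕ c) (sym ℓ≡x+1) x+1<c) ca′

  lower-head : ∀ {a b c : Fin (suc n)} → a <ᶠ b → b <ᶠ c → suc (toℕ x) ≡ toℕ b →
               Before w c a → Before w a b → ⊥
  lower-head {a} {b} {c} a<b b<c x+1≡b ca ab with toℕ a ≟ toℕ x
  ... | yes a≡x = x⊀x+1 (subst₂ (Before w) (toℕ-injective (trans a≡x (sym (toℕ-inject₁ x))))
                                           (toℕ-injective (sym x+1≡b)) ab)
  ... | no a≢x = via (predecessor x (≤-<-trans z≤n a<x))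
    where
      a<x : toℕ a < toℕ x
      a<x = ≤∧≢⇒< (≤-pred (subst (toℕ a <_) (sym x+1≡b) a<b)) a≢x
      x+1<c : suc (toℕ x) < toℕ c
      x+1<c = subst (_< toℕ c) (sym x+1≡b) b<c
      sa : s x a ≡ a
      sa = s-fixes (<⇒≢ a<x) (<⇒≢ (<-trans a<x (n<1+n (toℕ x))))
      ca′ : Before (prod ws) c a
      ca′ = subst₂ (Before (prod ws))
              (s-fixes (≢-sym (<⇒≢ (<-trans (n<1+n (toℕ x)) x+1<c))) (≢-sym (<⇒≢ x+1<c))) sa
              (Before-s∘ x ca)
      ax′ : Before (prod ws) a (inject₁ x)
      ax′ = subst₂ (Before (prod ws)) sa (trans (cong (s x) (toℕ-injective (sym x+1≡b))) (s-fsuc x))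
              (Before-s∘ x ab)
      via : Σ (Fin n) (λ ℓ → suc (toℕ ℓ) ≡ toℕ x) → ⊥
      via (ℓ , ℓ+1≡x) with Any.any? (ℓ ≟ᶠ_) cl
      ... | yes ℓ∈cl = proj₂ ih (subst (toℕ a <_) (sym (toℕ-inject₁ x)) a<x)
                                (subst (_< toℕ c) (sym (toℕ-inject₁ x)) (<-trans (n<1+n (toℕ x)) x+1<c))
                                (x , ℓ , sym (toℕ-inject₁ x) , trans ℓ+1≡x (sym (toℕ-inject₁ x))
                                   , EarlierIn-last ℓ∈cl)
                                ca′ ax′
      ... | no ℓ∉cl  = no-crossing ws (unused (λ e → <-irrefl e ℓ<x) ℓ∉cl)
                                  (≤-pred (subst (toℕ a <_) (sym ℓ+1≡x) a<x))
                                  (<-trans ℓ<x (<-trans (n<1+n (toℕ x)) x+1<c)) ca′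
        where
          ℓ<x : toℕ ℓ < toℕ x
          ℓ<x = subst (toℕ ℓ <_) ℓ+1≡x (n<1+n (toℕ ℓ))

  upper-tail : ∀ {a b c : Fin (suc n)} {y z : Fin n} → a <ᶠ b → b <ᶠ c →
               toℕ y ≡ toℕ b → suc (toℕ z) ≡ toℕ b → EarlierIn cl y z →
               Before w b c → Before w c a → ⊥
  upper-tail {c = c} a<b b<c y≡b z+1≡b ear bc ca =
    proj₁ ih (s-below-fixed sb a<b) (s-above-fixed sb b<c) (_ , _ , y≡b , z+1≡b , EarlierIn-++ ear)
             (subst (λ t → Before (prod ws) t (s x c)) sb (Before-s∘ x bc)) (Before-s∘ x ca)
    where sb = fixes-tail-barred (proj₁ (EarlierIn-∈ ear)) (proj₂ (EarlierIn-∈ ear)) y≡b z+1≡b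

  lower-tail : ∀ {a b c : Fin (suc n)} {y z : Fin n} → a <ᶠ b → b <ᶠ c →
               toℕ y ≡ toℕ b → suc (toℕ z) ≡ toℕ b → EarlierIn cl z y →
               Before w c a → Before w a b → ⊥
  lower-tail {a = a} a<b b<c y≡b z+1≡b ear ca ab =
    proj₂ ih (s-below-fixed sb a<b) (s-above-fixed sb b<c) (_ , _ , y≡b , z+1≡b , EarlierIn-++ ear)
             (Before-s∘ x ca) (subst (Before (prod ws) (s x a)) sb (Before-s∘ x ab))
    where sb = fixes-tail-barred (proj₂ (EarlierIn-∈ ear)) (proj₁ (EarlierIn-∈ ear)) y≡b z+1≡b

  avoids : Avoids231 (x ∷ cl) w × Avoids312 (x ∷ cl) w
  avoids = (λ { a<b b<c (_ , _ , x≡b , _ , here _)            → upper-head a<b b<c x≡b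
              ; a<b b<c (_ , _ , y≡b , z+1≡b , there ear)     → upper-tail a<b b<c y≡b z+1≡b ear })
         , (λ { a<b b<c (_ , _ , _ , x+1≡b , here _)          → lower-head a<b b<c x+1≡b
              ; a<b b<c (_ , _ , y≡b , z+1≡b , there ear)     → lower-tail a<b b<c y≡b z+1≡b ear })

unique-rotate : {A : Set} {x : A} {l : List A} → Unique (x ∷ l) → Unique (l ++ x ∷ [])
unique-rotate (x≢l ∷ uniq) = Unique.++⁺ uniq ([] ∷ []) λ { (v∈l , here refl) → All¬⇒¬Any x≢l v∈l }

cyclic-word-avoids : {cl ws : List (Fin n)} → CyclicWord cl ws → Unique cl →
                     inversions (prod ws) ≡ length ws → Avoids231 cl (prod ws) × Avoids312 cl (prod ws)
cyclic-word-avoids [] _ _ = id-avoids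
cyclic-word-avoids (skip word) (x≢cl ∷ uniq) count =
  skip-avoids (All¬⇒¬Any x≢cl ∘ CyclicWord-⊆ word) (cyclic-word-avoids word uniq count)
cyclic-word-avoids (use {x} {cl} {ws} word) uniq@(x≢cl ∷ _) count with reduced-cons x ws count
... | count′ , x+1≺x =
  UseStep.avoids word (All¬⇒¬Any x≢cl) (cyclic-word-avoids word (unique-rotate uniq) count′) x+1≺x

-- Sorting words of c-sortable permutations

_<ₗ_ : ℕ × ℕ → ℕ × ℕ → Set
(j , r) <ₗ (j′ , r′) = j < j′ ⊎ (j ≡ j′ × r < r′)

_≤ₗ_ : ℕ × ℕ → ℕ × ℕ → Set
(j , r) ≤ₗ (j′ , r′) = j < j′ ⊎ (j ≡ j′ × r ≤ r′)

<ₗ⇒≤ₗ : ∀ {p q} → p <ₗ q → p ≤ₗ q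
<ₗ⇒≤ₗ (inj₁ j<j′)        = inj₁ j<j′
<ₗ⇒≤ₗ (inj₂ (refl , r<r′)) = inj₂ (refl , <⇒≤ r<r′)

≤ₗ-trans : ∀ {p q t} → p ≤ₗ q → q ≤ₗ t → p ≤ₗ t
≤ₗ-trans (inj₁ j<)        (inj₁ j<′)         = inj₁ (<-trans j< j<′)
≤ₗ-trans (inj₁ j<)        (inj₂ (refl , _))  = inj₁ j<
≤ₗ-trans (inj₂ (refl , _)) (inj₁ j<′)        = inj₁ j<′
≤ₗ-trans (inj₂ (refl , r≤)) (inj₂ (refl , r≤′)) = inj₂ (refl , ≤-trans r≤ r≤′)

<ₗ-≤ₗ-trans : ∀ {p q t} → p <ₗ q → q ≤ₗ t → p <ₗ t
<ₗ-≤ₗ-trans (inj₁ j<)        (inj₁ j<′)         = inj₁ (<-trans j< j<′)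
<ₗ-≤ₗ-trans (inj₁ j<)        (inj₂ (refl , _))  = inj₁ j<
<ₗ-≤ₗ-trans (inj₂ (refl , _)) (inj₁ j<′)        = inj₁ j<′
<ₗ-≤ₗ-trans (inj₂ (refl , r<)) (inj₂ (refl , r≤)) = inj₂ (refl , <-≤-trans r< r≤)

≤ₗ⇒≯ₗ : ∀ {p q} → p ≤ₗ q → ¬ q <ₗ p
≤ₗ⇒≯ₗ (inj₁ j<)         (inj₁ j>)          = <-asym j< j>
≤ₗ⇒≯ₗ (inj₁ j<)         (inj₂ (refl , _))  = <-irrefl refl j<
≤ₗ⇒≯ₗ (inj₂ (refl , _)) (inj₁ j>)          = <-irrefl refl j>
≤ₗ⇒≯ₗ (inj₂ (refl , r≤)) (inj₂ (_ , r>))   = <⇒≱ r> r≤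

key : Pos n → ℕ × ℕ
key (j , r) = j , toℕ r

Increasing-head : {q : Pos n} {qs : List (Pos n)} → Increasing (q ∷ qs) → ∀ {p} → p ∈ qs → key q <ₗ key p
Increasing-head (inc-∷ _ _ _ q<q′ _)    (here refl) = q<q′
Increasing-head (inc-∷ _ _ _ q<q′ rest) (there p∈) = <ₗ-≤ₗ-trans q<q′ (<ₗ⇒≤ₗ (Increasing-head rest p∈))

Increasing-tail : {q : Pos n} {qs : List (Pos n)} → Increasing (q ∷ qs) → Increasing qs
Increasing-tail (inc-one _)         = inc-[]
Increasing-tail (inc-∷ _ _ _ _ rest) = rest

drop-tabulate : {A : Set} (f : Fin n → A) (i : Fin n) →
                drop (toℕ i) (tabulate f) ≡ f i ∷ drop (suc (toℕ i)) (tabulate f)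
drop-tabulate f fzero = refl
drop-tabulate f (fsuc i) = drop-tabulate (f ∘ fsuc) i

c-letters : Coxeter n → List (Fin n)
c-letters a = tabulate (a ⟨$⟩ʳ_)

⟨$⟩ʳ-injective : (a : Coxeter n) {r r′ : Fin n} → a ⟨$⟩ʳ r ≡ a ⟨$⟩ʳ r′ → r ≡ r′
⟨$⟩ʳ-injective a e = trans (sym (inverseˡ a)) (trans (cong (a ⟨$⟩ˡ_) e) (inverseˡ a))

module SortingWord (a : Coxeter n) (ps : List (Pos n))
  (nested : ∀ (j : ℕ) (x : Fin n) → x ∈K suc j [ a , ps ] → x ∈K j [ a , ps ]) where

  L : List (Fin n)
  L = c-letters a

  Alive : ℕ → Fin n → Set
  Alive zero    _ = ⊤
  Alive (suc j) x = x ∈K j [ a , ps ]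

  alive? : ∀ j → Decidable (Alive j)
  alive? zero    _ = yes tt
  alive? (suc j) x = map′ find (λ (_ , p∈ , prop) → lose p∈ prop)
                          (Any.any? (λ p → (proj₁ p ≟ j) ×-dec (a ⟨$⟩ʳ proj₂ p ≟ᶠ x)) ps)

  -- The queue just before position r of copy j of c^∞ is read: the rest of copy j, restricted
  -- to letters still alive, followed by the letters of copy j already used.
  queue : ℕ → ℕ → List (Fin n)
  queue j r = filter (alive? j) (drop r L) ++ filter (alive? (suc j)) (take r L)

  private
    front back : ℕ → Fin n → List (Fin n)
    front j ρ = filter (alive? j) (drop (suc (toℕ ρ)) L)
    back  j ρ = filter (alive? (suc j)) (take (toℕ ρ) L)

    queue-at : ∀ j ρ →
               queue j (toℕ ρ) ≡ filter (alive? j) ((a ⟨$⟩ʳ ρ) ∷ drop (suc (toℕ ρ)) L) ++ back j ρ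
    queue-at j ρ = cong (λ l → filter (alive? j) l ++ back j ρ) (drop-tabulate (a ⟨$⟩ʳ_) ρ)

    queue-next : ∀ j ρ →
                 queue j (suc (toℕ ρ)) ≡ front j ρ ++ (back j ρ ++ filter (alive? (suc j)) ((a ⟨$⟩ʳ ρ) ∷ []))
    queue-next j ρ = cong (front j ρ ++_)
      (trans (cong (filter (alive? (suc j))) (take-suc-tabulate (a ⟨$⟩ʳ_) ρ))
             (filter-++ (alive? (suc j)) (take (toℕ ρ) L) ((a ⟨$⟩ʳ ρ) ∷ [])))

    dropped : ∀ j ρ → (j , ρ) ∉ ps → queue j (suc (toℕ ρ)) ≡ front j ρ ++ back j ρ
    dropped j ρ unused = trans (queue-next j ρ) (cong (front j ρ ++_)
      (trans (cong (back j ρ ++_) (filter-reject (alive? (suc j)) notUsed)) (++-identityʳ (back j ρ))))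
      where
        notUsed : ¬ Alive (suc j) (a ⟨$⟩ʳ ρ)
        notUsed ((_ , ρ′) , p∈ , refl , aρ′≡aρ) =
          unused (subst (λ r → (j , r) ∈ ps) (⟨$⟩ʳ-injective a aρ′≡aρ) p∈)

  step-unused : ∀ {ws} j (ρ : Fin n) → (j , ρ) ∉ ps →
                CyclicWord (queue j (suc (toℕ ρ))) ws → CyclicWord (queue j (toℕ ρ)) ws
  step-unused {ws} j ρ unused word with alive? j (a ⟨$⟩ʳ ρ)
  ... | yes alive = subst (λ q → CyclicWord q ws)
          (sym (trans (queue-at j ρ) (cong (_++ back j ρ) (filter-accept (alive? j) alive))))
          (skip (subst (λ q → CyclicWord q ws) (dropped j ρ unused) word))
  ... | no dead = subst (λ q → CyclicWord q ws)
          (sym (trans (queue-at j ρ) (cong (_++ back j ρ) (filter-reject (alive? j) dead))))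
          (subst (λ q → CyclicWord q ws) (dropped j ρ unused) word)

  step-used : ∀ {ws} j (ρ : Fin n) → (j , ρ) ∈ ps →
              CyclicWord (queue j (suc (toℕ ρ))) ws → CyclicWord (queue j (toℕ ρ)) ((a ⟨$⟩ʳ ρ) ∷ ws)
  step-used {ws} j ρ used word =
    subst (λ q → CyclicWord q ((a ⟨$⟩ʳ ρ) ∷ ws)) (sym atρ) (use (subst (λ q → CyclicWord q ws) next word))
    where
      usedHere : Alive (suc j) (a ⟨$⟩ʳ ρ)
      usedHere = (j , ρ) , used , refl , refl
      aliveBefore : ∀ j → Alive (suc j) (a ⟨$⟩ʳ ρ) → Alive j (a ⟨$⟩ʳ ρ)
      aliveBefore zero    _ = tt
      aliveBefore (suc j) h = nested j (a ⟨$⟩ʳ ρ) h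
      atρ : queue j (toℕ ρ) ≡ (a ⟨$⟩ʳ ρ) ∷ (front j ρ ++ back j ρ)
      atρ = trans (queue-at j ρ) (cong (_++ back j ρ) (filter-accept (alive? j) (aliveBefore j usedHere)))
      next : queue j (suc (toℕ ρ)) ≡ (front j ρ ++ back j ρ) ++ (a ⟨$⟩ʳ ρ) ∷ []
      next = trans (queue-next j ρ)
        (trans (cong (λ l → front j ρ ++ (back j ρ ++ l)) (filter-accept (alive? (suc j)) usedHere))
               (sym (++-assoc (front j ρ) (back j ρ) _)))

  queue-wrap : ∀ j → queue j n ≡ queue (suc j) 0
  queue-wrap j = trans (cong₂ (λ d t → filter (alive? j) d ++ filter (alive? (suc j)) t)
                              (drop-all n L everything) (take-all n L everything))
                       (sym (++-identityʳ (filter (alive? (suc j)) L)))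
    where
      everything : length L ≤ n
      everything = ≤-reflexive (length-tabulate (a ⟨$⟩ʳ_))

  Unused : ℕ × ℕ → ℕ × ℕ → Set
  Unused from to = ∀ {p} → p ∈ ps → from ≤ₗ key p → ¬ key p <ₗ to

  rewind-copy : ∀ {ws} j {r} r′ → r ≤ r′ → r′ ≤ n → Unused (j , r) (j , r′) →
                CyclicWord (queue j r′) ws → CyclicWord (queue j r) ws
  rewind-copy j zero z≤n _ _ word = word
  rewind-copy {ws} j {r} (suc r′) r≤r′+1 r′<n unused word with m≤n⇒m<n∨m≡n r≤r′+1
  ... | inj₂ refl = word
  ... | inj₁ (s≤s r≤r′) =
    rewind-copy j r′ r≤r′ (<⇒≤ r′<n) unused′ (step (subst (λ t → CyclicWord (queue j (suc t)) ws) (sym ρ≡r′) word))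
    where
      ρ = fromℕ< r′<n
      ρ≡r′ : toℕ ρ ≡ r′
      ρ≡r′ = toℕ-fromℕ< r′<n
      step : CyclicWord (queue j (suc (toℕ ρ))) ws → CyclicWord (queue j r′) ws
      step = subst (λ t → CyclicWord (queue j t) ws) ρ≡r′ ∘ step-unused j ρ λ ρ∈ →
        unused ρ∈ (inj₂ (refl , subst (r ≤_) (sym ρ≡r′) r≤r′))
                  (inj₂ (refl , subst (_< suc r′) (sym ρ≡r′) ≤-refl))
      unused′ : Unused (j , r) (j , r′)
      unused′ p∈ from< p< = unused p∈ from< (<ₗ-≤ₗ-trans p< (inj₂ (refl , n≤1+n r′)))

  rewind : ∀ {ws j r} j′ r′ → (j , r) ≤ₗ (j′ , r′) → r ≤ n → r′ ≤ n → Unused (j , r) (j′ , r′) →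
           CyclicWord (queue j′ r′) ws → CyclicWord (queue j r) ws
  rewind j′ r′ (inj₂ (refl , r≤r′)) _ r′≤n unused = rewind-copy j′ r′ r≤r′ r′≤n unused
  rewind {ws} {j} {r} (suc j′) r′ (inj₁ (s≤s j≤j′)) r≤n r′≤n unused =
    rewind j′ n before r≤n ≤-refl unusedEarlier
    ∘ subst (λ q → CyclicWord q ws) (sym (queue-wrap j′))
    ∘ rewind-copy (suc j′) r′ z≤n r′≤n unusedHere
    where
      before : (j , r) ≤ₗ (j′ , n)
      before with m≤n⇒m<n∨m≡n j≤j′
      ... | inj₁ j<j′ = inj₁ j<j′
      ... | inj₂ refl = inj₂ (refl , r≤n)
      unusedEarlier : Unused (j , r) (j′ , n)
      unusedEarlier p∈ from< p< = unused p∈ from< (<ₗ-≤ₗ-trans p< (inj₁ (n<1+n j′)))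
      unusedHere : Unused (suc j′ , 0) (suc j′ , r′)
      unusedHere p∈ from< = unused p∈ (≤ₗ-trans (inj₁ (s≤s j≤j′)) from<)

  suffix-cyclic : ∀ qs j r → r ≤ n → Increasing qs → (∀ {p} → p ∈ qs → p ∈ ps) →
                  (∀ {p} → p ∈ qs → (j , r) ≤ₗ key p) → (∀ {p} → p ∈ ps → p ∈ qs ⊎ key p <ₗ (j , r)) →
                  CyclicWord (queue j r) (letters a qs)
  suffix-cyclic [] _ _ _ _ _ _ _ = []
  suffix-cyclic ((j′ , ρ) ∷ qs) j r r≤n inc sub after covered =
    rewind j′ (toℕ ρ) (after (here refl)) r≤n (<⇒≤ (toℕ<n ρ)) unusedBefore
      (step-used j′ ρ (sub (here refl))
        (suffix-cyclic qs j′ (suc (toℕ ρ)) (toℕ<n ρ) (Increasing-tail inc) (sub ∘ there) after′ covered′))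
    where
      after′ : ∀ {p} → p ∈ qs → (j′ , suc (toℕ ρ)) ≤ₗ key p
      after′ p∈ with Increasing-head inc p∈
      ... | inj₁ j′<          = inj₁ j′<
      ... | inj₂ (refl , ρ<) = inj₂ (refl , ρ<)
      covered′ : ∀ {p} → p ∈ ps → p ∈ qs ⊎ key p <ₗ (j′ , suc (toℕ ρ))
      covered′ p∈ with covered p∈
      ... | inj₁ (here refl) = inj₂ (inj₂ (refl , ≤-refl))
      ... | inj₁ (there p∈qs) = inj₁ p∈qs
      ... | inj₂ p< = inj₂ (<ₗ-≤ₗ-trans p< (≤ₗ-trans (after (here refl)) (inj₂ (refl , n≤1+n (toℕ ρ)))))
      unusedBefore : Unused (j , r) (j′ , toℕ ρ)
      unusedBefore p∈ from< p< with covered p∈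
      ... | inj₁ (here refl)  = ≤ₗ⇒≯ₗ (inj₂ (refl , ≤-refl)) p<
      ... | inj₁ (there p∈qs) = ≤ₗ⇒≯ₗ (<ₗ⇒≤ₗ (Increasing-head inc p∈qs)) p<
      ... | inj₂ p<′          = ≤ₗ⇒≯ₗ from< p<′

  sorting-word-cyclic : Increasing ps → CyclicWord L (letters a ps)
  sorting-word-cyclic inc = subst (λ q → CyclicWord q (letters a ps)) start
    (suffix-cyclic ps 0 0 z≤n inc (λ p∈ → p∈) (λ {p} _ → origin p) inj₁)
    where
      origin : ∀ p → (0 , 0) ≤ₗ key p
      origin (zero , _)  = inj₂ (refl , z≤n)
      origin (suc _ , _) = inj₁ z<s
      start : queue 0 0 ≡ L
      start = trans (++-identityʳ _) (filter-all (alive? 0) (All.universal (λ _ → tt) L))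

sortable-avoids : (a : Coxeter n) {w : Perm n} → Sortable a w →
                  Avoids231 (c-letters a) w × Avoids312 (c-letters a) w
sortable-avoids a {w} (ps , ((inc , red) , _) , nested) =
  transport (cyclic-word-avoids (SortingWord.sorting-word-cyclic a ps nested inc)
                                (Unique.tabulate⁺ (⟨$⟩ʳ-injective a))
                                (trans (inversions-cong (proj₁ red))
                                       (reduced⇒inversions {ws = letters a ps} {w = w} red)))
  where
    back : ∀ {x y} → Before w x y → Before (prod (letters a ps)) x y
    back = Before-≈ (λ i → sym (proj₁ red i))
    transport : Avoids231 (c-letters a) (prod (letters a ps)) × Avoids312 (c-letters a) (prod (letters a ps)) →
                Avoids231 (c-letters a) w × Avoids312 (c-letters a) w
    transport (upper , lower) = (λ a<b b<c barred bc ca → upper a<b b<c barred (back bc) (back ca))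
                              , (λ a<b b<c barred ca ab → lower a<b b<c barred (back ca) (back ab))

EarlierIn-tabulate : {A : Set} (f : Fin n → A) {i j : Fin n} → i <ᶠ j → EarlierIn (tabulate f) (f i) (f j)
EarlierIn-tabulate f {fzero}  {fsuc j} _         = here (∈-tabulate⁺ {f = f ∘ fsuc} j)
EarlierIn-tabulate f {fsuc i} {fsuc j} (s≤s i<j) = there (EarlierIn-tabulate (f ∘ fsuc) i<j)

Precedes⇒EarlierIn : (a : Coxeter n) {x y : Fin n} → Precedes a x y → EarlierIn (c-letters a) x y
Precedes⇒EarlierIn a x≺y =
  subst₂ (EarlierIn (c-letters a)) (inverseʳ a) (inverseʳ a) (EarlierIn-tabulate (a ⟨$⟩ʳ_) x≺y)

private
  barred-letters : {b : Fin (suc n)} {x y : Fin n} → toℕ x + 2 ≡ toℕ b + 1 → toℕ y + 1 ≡ toℕ b + 1 →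
                   toℕ y ≡ toℕ b × suc (toℕ x) ≡ toℕ b
  barred-letters {b = b} {x} {y} x+2≡ y+1≡ =
      +-cancelʳ-≡ 1 (toℕ y) (toℕ b) y+1≡
    , +-cancelʳ-≡ 1 (suc (toℕ x)) (toℕ b) (trans (sym (+-suc (toℕ x) 1)) x+2≡)

UpperBarred⇒UpperBarredIn : (a : Coxeter n) (b : Fin (suc n)) → UpperBarred a (toℕ b + 1) →
                            UpperBarredIn (c-letters a) b
UpperBarred⇒UpperBarredIn a b (_ , _ , x , y , x+2≡ , y+1≡ , x⊀y) =
  y , x , y≡b , x+1≡b , Precedes⇒EarlierIn a (≤∧≢⇒< (≮⇒≥ x⊀y) y≢x)
  where
    y≡b = proj₁ (barred-letters {b = b} x+2≡ y+1≡)
    x+1≡b = proj₂ (barred-letters {b = b} x+2≡ y+1≡)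
    y≢x : toℕ (a ⟨$⟩ˡ y) ≢ toℕ (a ⟨$⟩ˡ x)
    y≢x e = <-irrefl (sym (trans x+1≡b (trans (sym y≡b) (cong toℕ (permutation-injective (toℕ-injective e))))))
                     (n<1+n (toℕ x))
      where permutation-injective = λ e → trans (sym (inverseʳ a)) (trans (cong (a ⟨$⟩ʳ_) e) (inverseʳ a))

LowerBarred⇒LowerBarredIn : (a : Coxeter n) (b : Fin (suc n)) → LowerBarred a (toℕ b + 1) →
                            LowerBarredIn (c-letters a) b
LowerBarred⇒LowerBarredIn a b (_ , _ , x , y , x+2≡ , y+1≡ , x≺y) =
  y , x , proj₁ (barred-letters {b = b} x+2≡ y+1≡) , proj₂ (barred-letters {b = b} x+2≡ y+1≡)
    , Precedes⇒EarlierIn a x≺y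

-- Pigeonhole and crossing arguments

InRange : ℕ → ℕ → ℕ → Set
InRange lo len k = lo ≤ k × k < lo + len

inRange? : ∀ lo len k → Dec (InRange lo len k)
inRange? lo len k = (lo ≤? k) ×-dec (k <? lo + len)

interval-crowding : {u : Perm n} (inv : Invertible u) {v₀ m p₀ t : ℕ} → v₀ + m ≤ suc n →
                    (∀ v → InRange v₀ m (toℕ v) → InRange p₀ t (toℕ (position inv v))) → m ≤ t
interval-crowding {n} {u} inv {v₀} {m} {p₀} {t} fits placed = injective⇒≤ {f = offset} offset-injective
  where
    value : Fin m → Fin (suc n)
    value k = fromℕ< (<-≤-trans (+-monoʳ-< v₀ (toℕ<n k)) fits)
    toℕ-value : ∀ k → toℕ (value k) ≡ v₀ + toℕ k
    toℕ-value k = toℕ-fromℕ< _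
    placed-value : ∀ k → InRange p₀ t (toℕ (position inv (value k)))
    placed-value k = placed (value k)
      ( subst (v₀ ≤_) (sym (toℕ-value k)) (m≤m+n v₀ (toℕ k))
      , subst (_< v₀ + m) (sym (toℕ-value k)) (+-monoʳ-< v₀ (toℕ<n k)))
    offset : Fin m → Fin t
    offset k = fromℕ< (subst (toℕ (position inv (value k)) ∸ p₀ <_) (m+n∸m≡n p₀ t)
                 (∸-monoˡ-< (proj₂ (placed-value k)) (proj₁ (placed-value k))))
    offset-injective : Injective _≡_ _≡_ offset
    offset-injective {k} {k′} e = toℕ-injective (+-cancelˡ-≡ v₀ (toℕ k) (toℕ k′) (begin
      v₀ + toℕ k                        ≡⟨ toℕ-value k ⟨
      toℕ (value k)                     ≡⟨ cong toℕ same-value ⟩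
      toℕ (value k′)                    ≡⟨ toℕ-value k′ ⟩
      v₀ + toℕ k′                       ∎))
      where
        open ≡-Reasoning
        same-position : position inv (value k) ≡ position inv (value k′)
        same-position = toℕ-injective (∸-cancelʳ-≡ (proj₁ (placed-value k)) (proj₁ (placed-value k′))
          (trans (sym (toℕ-fromℕ< _)) (trans (cong toℕ e) (toℕ-fromℕ< _))))
        same-value : value k ≡ value k′
        same-value = trans (sym (at-position inv (value k))) (trans (cong u same-position) (at-position inv (value k′)))

value-escapes : {u : Perm n} (inv : Invertible u) {v₀ m p₀ t : ℕ} → v₀ + m ≤ suc n → t < m →
                Σ (Fin (suc n)) λ v → InRange v₀ m (toℕ v) × ¬ InRange p₀ t (toℕ (position inv v))
value-escapes inv {v₀} {m} {p₀} {t} fits t<m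
  with any? (λ v → inRange? v₀ m (toℕ v) ×-dec ¬? (inRange? p₀ t (toℕ (position inv v))))
... | yes found = found
... | no none = ⊥-elim (<⇒≱ t<m (interval-crowding inv fits λ v inV →
                  decidable-stable (inRange? p₀ t _) (λ out → none (v , inV , out))))

value-right-of : {w : Perm n} (inv : Invertible w) (i : Fin (suc n)) {v₀ m : ℕ} → v₀ + m ≤ suc n →
                 toℕ i < m → ¬ InRange v₀ m (toℕ (w i)) →
                 Σ (Fin (suc n)) λ p → i <ᶠ p × InRange v₀ m (toℕ (w p))
value-right-of {w = w} inv i {v₀} {m} fits i<m wi∉ with value-escapes inv {p₀ = 0} {t = toℕ i} fits i<m
... | v , inV , notLeft =
  position inv v , ≤∧≢⇒< i≤p i≢p , subst (InRange v₀ m ∘ toℕ) (sym (at-position inv v)) inV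
  where
    i≤p : toℕ i ≤ toℕ (position inv v)
    i≤p = ≮⇒≥ (λ p<i → notLeft (z≤n , p<i))
    i≢p : toℕ i ≢ toℕ (position inv v)
    i≢p e = wi∉ (subst (InRange v₀ m ∘ toℕ) (sym (trans (cong w (toℕ-injective e)) (at-position inv v))) inV)

value-left-of : {w : Perm n} (inv : Invertible w) (i : Fin (suc n)) {v₀ m : ℕ} → v₀ + m ≤ suc n →
                n ∸ toℕ i < m → ¬ InRange v₀ m (toℕ (w i)) →
                Σ (Fin (suc n)) λ p → p <ᶠ i × InRange v₀ m (toℕ (w p))
value-left-of {n} {w} inv i {v₀} {m} fits n-i<m wi∉
  with value-escapes inv {p₀ = suc (toℕ i)} {t = n ∸ toℕ i} fits n-i<m
... | v , inV , notRight =
  position inv v , ≤∧≢⇒< p≤i (i≢p ∘ sym) , subst (InRange v₀ m ∘ toℕ) (sym (at-position inv v)) inV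
  where
    p<end : toℕ (position inv v) < suc (toℕ i) + (n ∸ toℕ i)
    p<end = subst (toℕ (position inv v) <_) (sym (cong suc (m+[n∸m]≡n (toℕ≤pred[n] i))))
                  (toℕ<n (position inv v))
    p≤i : toℕ (position inv v) ≤ toℕ i
    p≤i = ≤-pred (≰⇒> (λ i<p → notRight (i<p , p<end)))
    i≢p : toℕ i ≢ toℕ (position inv v)
    i≢p e = wi∉ (subst (InRange v₀ m ∘ toℕ) (sym (trans (cong w (toℕ-injective e)) (at-position inv v))) inV)

last-switch : (P : ℕ → Set) → Decidable P → ∀ {p q} → p ≤ q → P p → ¬ P q →
              Σ ℕ λ k → p ≤ k × k < q × P k × ¬ P (suc k)
last-switch P P? {p} {zero} p≤0 Pp ¬P0 = ⊥-elim (¬P0 (subst P (n≤0⇒n≡0 p≤0) Pp))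
last-switch P P? {p} {suc q} p≤q+1 Pp ¬Pq+1 with m≤n⇒m<n∨m≡n p≤q+1
... | inj₂ refl = ⊥-elim (¬Pq+1 Pp)
... | inj₁ (s≤s p≤q) with P? q
...   | yes Pq = q , p≤q , ≤-refl , Pq , ¬Pq+1
...   | no ¬Pq with last-switch P P? p≤q Pp ¬Pq
...     | k , p≤k , k<q , Pk , ¬Pk+1 = k , p≤k , m≤n⇒m≤1+n k<q , Pk , ¬Pk+1

ascent-across : (w : Perm n) (u : Fin (suc n)) {p q : Fin (suc n)} → p <ᶠ q → w p <ᶠ u → u <ᶠ w q →
                (∀ r → p ≤ᶠ r → r ≤ᶠ q → w r ≢ u) →
                Σ (Fin n) λ k → p ≤ᶠ inject₁ k × fsuc k ≤ᶠ q × w (inject₁ k) <ᶠ u × u <ᶠ w (fsuc k)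
ascent-across {n} w u {p} {q} p<q wp<u u<wq avoids =
  crossing (last-switch Below below? (<⇒≤ p<q) (p , refl , wp<u) notBelow)
  where
    Below : ℕ → Set
    Below k = Σ (Fin (suc n)) λ r → toℕ r ≡ k × w r <ᶠ u
    below? : Decidable Below
    below? k = any? λ r → (toℕ r ≟ k) ×-dec (toℕ (w r) <? toℕ u)
    notBelow : ¬ Below (toℕ q)
    notBelow (r , r≡q , wr<u) = <-asym (subst (λ r → u <ᶠ w r) (sym (toℕ-injective r≡q)) u<wq) wr<u
    crossing : Σ ℕ (λ k → toℕ p ≤ k × k < toℕ q × Below k × ¬ Below (suc k)) →
               Σ (Fin n) λ k → p ≤ᶠ inject₁ k × fsuc k ≤ᶠ q × w (inject₁ k) <ᶠ u × u <ᶠ w (fsuc k)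
    crossing (k , p≤k , k<q , (r , r≡k , wr<u) , notBelow′) =
      ℓ , subst (toℕ p ≤_) (sym ℓ≡k) p≤k , subst (_≤ toℕ q) (sym ℓ+1≡k+1) k<q
        , subst (λ r → w r <ᶠ u) (sym ℓ≡r) wr<u , ≤∧≢⇒< u≤wℓ+1 u≢wℓ+1
      where
        k<n : k < n
        k<n = <-≤-trans k<q (toℕ≤pred[n] q)
        ℓ = fromℕ< k<n
        ℓ≡k : toℕ (inject₁ ℓ) ≡ k
        ℓ≡k = trans (toℕ-inject₁ ℓ) (toℕ-fromℕ< k<n)
        ℓ≡r : inject₁ ℓ ≡ r
        ℓ≡r = toℕ-injective (trans ℓ≡k (sym r≡k))
        ℓ+1≡k+1 : toℕ (fsuc ℓ) ≡ suc k
        ℓ+1≡k+1 = cong suc (toℕ-fromℕ< k<n)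
        u≤wℓ+1 : toℕ u ≤ toℕ (w (fsuc ℓ))
        u≤wℓ+1 = ≮⇒≥ (λ lt → notBelow′ (fsuc ℓ , ℓ+1≡k+1 , lt))
        u≢wℓ+1 : toℕ u ≢ toℕ (w (fsuc ℓ))
        u≢wℓ+1 e = avoids (fsuc ℓ) (subst (toℕ p ≤_) (sym ℓ+1≡k+1) (m≤n⇒m≤1+n p≤k))
                                   (subst (_≤ toℕ q) (sym ℓ+1≡k+1) k<q) (toℕ-injective (sym e))

-- c-singletons

sortable-invertible : {a : Coxeter n} {w : Perm n} → Sortable a w → Invertible w
sortable-invertible {a = a} (ps , ((_ , red) , _) , _) = ≈-invertible (proj₁ red) (prod-invertible (letters a ps))

⊆Inv-keeps-order : {u v : Perm n} → Invertible u → Injective _≡_ _≡_ v → u ⊆Inv v →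
                   ∀ {x y} → x <ᶠ y → Before v x y → Before u x y
⊆Inv-keeps-order inv-u inj-v u⊆v x<y bef with Before-total inv-u (λ e → <-irrefl (cong toℕ e) x<y)
... | inj₁ kept    = kept
... | inj₂ flipped = ⊥-elim (Before-asym inj-v bef (u⊆v x<y flipped))

-- π↓(w s_k) = w would contradict w being a c-singleton; so some c-sortable u ≤ w s_k
-- must invert the ascent of w at k.
singleton-cover : {a : Coxeter n} {w : Perm n} → Singleton a w → (k : Fin n) → Ascent w k →
                  (∀ u → Sortable a u → u ⊆Inv (w ∘ s k) → ¬ Before u (w (fsuc k)) (w (inject₁ k))) → ⊥
singleton-cover {n} {a} {w} (sortable@(ps , ((_ , red) , _) , _) , only) k asc noSwap =
  inject₁≢fsuc k (sym (injective inv-w (trans (cong w (sym (s-inject₁ k))) (v≈w (inject₁ k)))))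
  where
    open ≡-Reasoning
    ws = letters a ps
    inv-w : Invertible w
    inv-w = sortable-invertible {a = a} sortable
    v : Perm n
    v = w ∘ s k
    w≤v : w ≤R v
    w≤v = ws , k ∷ [] , red , inversions⇒reduced {ws = ws ++ k ∷ []}
      (λ i → trans (prod-++ ws (k ∷ []) i) (proj₁ red (s k i))) (begin
      inversions v           ≡⟨ inversions-∘s-ascent w k asc ⟩
      suc (inversions w)     ≡⟨ cong suc (reduced⇒inversions {ws = ws} red) ⟩
      suc (length ws)        ≡⟨ +-comm 1 (length ws) ⟩
      length ws + 1          ≡⟨ length-++ ws ⟨
      length (ws ++ k ∷ [])  ∎)
    below-v⇒below-w : ∀ u → Sortable a u → u ≤R v → u ≤R w
    below-v⇒below-w u sortable-u u≤v@(as , _ , red-u , _) = ⊆Inv⇒≤R {as = as} {u = u} red-u inv-w u⊆w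
      where
        u⊆v : u ⊆Inv v
        u⊆v = ≤R⇒⊆Inv u≤v
        u⊆w : u ⊆Inv w
        u⊆w x<y bef with Before-∘s k (u⊆v x<y bef)
        ... | inj₁ old           = old
        ... | inj₂ (refl , refl) = ⊥-elim (noSwap u sortable-u u⊆v bef)
    v≈w : v ≈ w
    v≈w = only v (sortable , w≤v , below-v⇒below-w)

singleton-avoids-upper : {a : Coxeter n} {w : Perm n} → Singleton a w → {u i : Fin (suc n)} →
                         UpperBarredIn (c-letters a) u → toℕ i < toℕ u → toℕ i < n ∸ toℕ u → w i ≢ u
singleton-avoids-upper {n} {a} {w} singleton@(sortable , _) {u} {i} barred i<u i<n-u refl =
  ordered (value-right-of inv i (<⇒≤ (toℕ<n u)) i<u (λ (_ , u<u) → <-irrefl refl u<u))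
          (value-right-of inv i fits i<n-u (λ (u<u , _) → <-irrefl refl u<u))
  where
    inv = sortable-invertible {a = a} sortable
    fits : suc (toℕ u) + (n ∸ toℕ u) ≤ suc n
    fits = ≤-reflexive (cong suc (m+[n∸m]≡n (toℕ≤pred[n] u)))
    ordered : (Σ (Fin (suc n)) λ p → i <ᶠ p × InRange 0 (toℕ u) (toℕ (w p))) →
              (Σ (Fin (suc n)) λ q → i <ᶠ q × InRange (suc (toℕ u)) (n ∸ toℕ u) (toℕ (w q))) → ⊥
    ordered (p , i<p , _ , wp<u) (q , i<q , u<wq , _) with <-cmp (toℕ p) (toℕ q)
    ... | tri≈ _ p≡q _ = <-asym wp<u (subst (λ r → u <ᶠ w r) (sym (toℕ-injective p≡q)) u<wq)
    ... | tri> _ _ q<p = proj₁ (sortable-avoids a sortable) wp<u u<wq barred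
                                (i , q , i<q , refl , refl) (q , p , q<p , refl , refl)
    ... | tri< p<q _ _ with ascent-across w u p<q wp<u u<wq
                              (λ r p≤r _ wr≡wi → <-irrefl (cong toℕ (sym (injective inv wr≡wi))) (<-≤-trans i<p p≤r))
    ...   | k , p≤k , _ , wk<u , u<wk+1 =
      singleton-cover {a = a} singleton k (<-trans wk<u u<wk+1) λ u′ sortable′ u′⊆v swapped →
        proj₁ (sortable-avoids a sortable′) wk<u u<wk+1 barred
              (⊆Inv-keeps-order (sortable-invertible {a = a} sortable′) (injective (∘s-invertible k inv))
                                u′⊆v u<wk+1 u-first)
              swapped
      where
        i<k : i <ᶠ inject₁ k
        i<k = <-≤-trans i<p p≤k
        u-first : Before (w ∘ s k) u (w (fsuc k))
        u-first = i , inject₁ k , i<k , cong w (s-fixes-left i<k) , cong w (s-inject₁ k)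

-- The mirror image: values below and above d sit left of i, and 312-avoidance orders them.
singleton-avoids-lower : {a : Coxeter n} {w : Perm n} → Singleton a w → {d i : Fin (suc n)} →
                         LowerBarredIn (c-letters a) d → toℕ d < toℕ i → n ∸ toℕ i < toℕ d → w i ≢ d
singleton-avoids-lower {n} {a} {w} singleton@(sortable , _) {d} {i} barred d<i n-i<d refl =
  ordered (value-left-of inv i (<⇒≤ (toℕ<n d)) n-i<d (λ (_ , d<d) → <-irrefl refl d<d))
          (value-left-of inv i fits (∸-monoʳ-< d<i (toℕ≤pred[n] i)) (λ (d<d , _) → <-irrefl refl d<d))
  where
    inv = sortable-invertible {a = a} sortable
    fits : suc (toℕ d) + (n ∸ toℕ d) ≤ suc n
    fits = ≤-reflexive (cong suc (m+[n∸m]≡n (toℕ≤pred[n] d)))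
    ordered : (Σ (Fin (suc n)) λ p → p <ᶠ i × InRange 0 (toℕ d) (toℕ (w p))) →
              (Σ (Fin (suc n)) λ q → q <ᶠ i × InRange (suc (toℕ d)) (n ∸ toℕ d) (toℕ (w q))) → ⊥
    ordered (p , p<i , _ , wp<d) (q , q<i , d<wq , _) with <-cmp (toℕ p) (toℕ q)
    ... | tri≈ _ p≡q _ = <-asym wp<d (subst (λ r → d <ᶠ w r) (sym (toℕ-injective p≡q)) d<wq)
    ... | tri> _ _ q<p = proj₂ (sortable-avoids a sortable) wp<d d<wq barred
                                (q , p , q<p , refl , refl) (p , i , p<i , refl , refl)
    ... | tri< p<q _ _ with ascent-across w d p<q wp<d d<wq
                              (λ r _ r≤q wr≡wi → <-irrefl (cong toℕ (injective inv wr≡wi)) (≤-<-trans r≤q q<i))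
    ...   | k , _ , k+1≤q , wk<d , d<wk+1 =
      singleton-cover {a = a} singleton k (<-trans wk<d d<wk+1) λ u′ sortable′ u′⊆v swapped →
        proj₂ (sortable-avoids a sortable′) wk<d d<wk+1 barred swapped
              (⊆Inv-keeps-order (sortable-invertible {a = a} sortable′) (injective (∘s-invertible k inv))
                                u′⊆v wk<d wk-first)
      where
        k<i : fsuc k <ᶠ i
        k<i = ≤-<-trans k+1≤q q<i
        wk-first : Before (w ∘ s k) (w (inject₁ k)) d
        wk-first = fsuc k , i , k<i , cong w (s-fsuc k) , cong w (s-fixes-right k<i)

upper-window : ∀ {i u} n → i + 1 ≤ (u + 1 ∸ 1) ⊓ (n + 1 ∸ (u + 1)) → i < u × i < n ∸ u
upper-window {i} {u} n window =
  subst₂ _≤_ (+-comm i 1) (m+n∸n≡m u 1) (m≤n⊓o⇒m≤n _ _ window) ,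
  subst₂ _≤_ (+-comm i 1) (cong₂ _∸_ (+-comm n 1) (+-comm u 1)) (m≤n⊓o⇒m≤o _ _ window)

lower-window : ∀ {i d} n → d ≤ n → i ≤ n → (d + 1 + 1) ⊔ (n + 3 ∸ (d + 1)) ≤ i + 1 → d < i × n ∸ i < d
lower-window {i} {d} n d≤n i≤n window = d<i , n-i<d
  where
    open ≤-Reasoning
    d<i : d < i
    d<i = ≤-pred (subst₂ _≤_ (trans (+-comm (d + 1) 1) (cong suc (+-comm d 1))) (+-comm i 1)
                             (m⊔n≤o⇒m≤o _ _ window))
    n+2∸d≤i+1 : suc (suc n) ∸ d ≤ suc i
    n+2∸d≤i+1 = subst₂ _≤_ (cong₂ _∸_ (+-comm n 3) (+-comm d 1)) (+-comm i 1) (m⊔n≤o⇒n≤o _ _ window)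
    n+1≤i+d : suc n ≤ i + d
    n+1≤i+d = ≤-pred (begin
      suc (suc n)              ≡⟨ m∸n+n≡m (m≤n⇒m≤1+n (m≤n⇒m≤1+n d≤n)) ⟨
      (suc (suc n) ∸ d) + d    ≤⟨ +-monoˡ-≤ d n+2∸d≤i+1 ⟩
      suc i + d                ∎)
    n-i<d : n ∸ i < d
    n-i<d = subst (_≤ d) (+-∸-assoc 1 i≤n) (m≤n+o⇒m∸n≤o (suc n) i n+1≤i+d)

PM-off : ∀ {n} (w : Perm n) {i j : Fin (suc n)} → w i ≢ j → PM w i j ≡ 0ℚ
PM-off w {i} {j} wi≢j rewrite dec-false (w i ≟ᶠ j) wi≢j = refl

InAff-entry-zero : ∀ {n} {a : Coxeter n} {X : Matrix n} → InAff a X → ∀ i j →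
                   (∀ w → Singleton a w → w i ≢ j) → X i j ≡ 0ℚ
InAff-entry-zero {a = a} (cs , singletons , _ , X≡) i j never = trans (X≡ i j) (terms-vanish cs singletons)
  where
    terms-vanish : ∀ cs → All (λ lw → Singleton a (proj₂ lw)) cs →
                   sumℚ (map (λ lw → proj₁ lw *ℚ PM (proj₂ lw) i j) cs) ≡ 0ℚ
    terms-vanish []             []             = refl
    terms-vanish ((λ′ , w) ∷ cs) (sing ∷ sings) = trans
      (cong₂ _+ℚ_ (trans (cong (λ′ *ℚ_) (PM-off w (never w sing))) (ℚ.*-zeroʳ λ′)) (terms-vanish cs sings))
      (ℚ.+-identityˡ 0ℚ)

proposition4p4 : ∀ (n : ℕ) (c : Coxeter n) (X : Matrix n) → InAff c X →
    (∀ (i u : Fin (suc n)) → UpperBarred c (toℕ u + 1) →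
       1 ≤ toℕ i + 1 → toℕ i + 1 ≤ (toℕ u + 1 ∸ 1) ⊓ (n + 1 ∸ (toℕ u + 1)) →
       X i u ≡ 0ℚ)
    ×
    (∀ (i d : Fin (suc n)) → LowerBarred c (toℕ d + 1) →
       (toℕ d + 1 + 1) ⊔ (n + 3 ∸ (toℕ d + 1)) ≤ toℕ i + 1 → toℕ i + 1 ≤ n + 1 →
       X i d ≡ 0ℚ)
proposition4p4 n c X inAff = upper , lower
  where
    -- The ignored bounds 1 ≤ toℕ i + 1 and toℕ i + 1 ≤ n + 1 hold for every i : Fin (suc n).
    upper : ∀ (i u : Fin (suc n)) → UpperBarred c (toℕ u + 1) → 1 ≤ toℕ i + 1 →
            toℕ i + 1 ≤ (toℕ u + 1 ∸ 1) ⊓ (n + 1 ∸ (toℕ u + 1)) → X i u ≡ 0ℚ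
    upper i u barred _ window with upper-window {toℕ i} {toℕ u} n window
    ... | i<u , i<n-u = InAff-entry-zero {a = c} inAff i u λ w singleton →
      singleton-avoids-upper {a = c} singleton (UpperBarred⇒UpperBarredIn c u barred) i<u i<n-u
    lower : ∀ (i d : Fin (suc n)) → LowerBarred c (toℕ d + 1) →
            (toℕ d + 1 + 1) ⊔ (n + 3 ∸ (toℕ d + 1)) ≤ toℕ i + 1 → toℕ i + 1 ≤ n + 1 → X i d ≡ 0ℚ
    lower i d barred window _ with lower-window n (toℕ≤pred[n] d) (toℕ≤pred[n] i) window
    ... | d<i , n-i<d = InAff-entry-zero {a = c} inAff i d λ w singleton →
      singleton-avoids-lower {a = c} singleton (LowerBarred⇒LowerBarredIn c d barred) d<i n-i<d
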